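{- Let $\Phi$ be irreducible with highest root $\gamma$, and let $v,w\in W$ with $v>w$ in Bruhat order. Then $\ell_\gamma(w)=\ell_\gamma(v)$ if and only if all of the following hold: $v$ is a cover of $w$; $N_w=N_w^\gamma$; and there exists $\beta\in N_v$ with $v^{ -1}\beta=-\gamma$.
   Context: $\Phi$ is a crystallographic root system in a real inner product space with base $\Delta$, positive roots $\Phi^+$, $\Phi^-=-\Phi^+$; $s_\alpha$ is the reflection in $\alpha$, $W$ the Weyl group with length function $\ell$. Order on $\Phi$: $\alpha\preceq\beta$ iff $\beta-\alpha$ is a nonnegative integer combination of simple roots. $\Phi$ irreducible means it is not a disjoint union of two nonempty root systems; then there is a unique highest root $\gamma$ with $\alpha\preceq\gamma$ for all $\alpha\in\Phi$. Bruhat order $<$ on $W$: transitive closure of $u<s_\alpha u$ for $\alpha\in\Phi^+$ with $(s_\alpha u)^{ -1}\alpha\in\Phi^-$. Let $\mathfrak h_\gamma=\Phi^+\setminus\{\gamma\}$. For $w\in W$: $N_w=\{\beta\in\Phi^+:w^{ -1}\beta\in\Phi^-\}$, $N_w^\gamma=\{\beta\in\Phi^+:w^{ -1}\beta\in-\mathfrak h_\gamma\}$, and $\ell_\gamma(w)=|N_w^\gamma|$. $v$ is a cover of $w$ if $v=s_\alpha w$ for some $\alpha\in\Phi^+$ and $\ell(v)=\ell(w)+1$.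
   Formalization: The root system Φ lies in ℚ^n equipped with a rational-valued inner product, rather than in a real inner product space. -}

module Defs where

open import Data.Nat using (ℕ; zero; suc; _≤_)
open import Data.Integer using (ℤ; +_)
open import Data.Rational using (ℚ; 0ℚ; 1ℚ; _+_; _*_; -_; _÷_; _/_; _<_)
open import Data.Rational.Base using (≢-nonZero)
open import Data.Rational.Properties using (_≟_)
open import Data.Fin using (Fin) renaming (zero to fzero; suc to fsuc)
open import Data.Vec using (Vec; map; zipWith; replicate)
open import Data.List using (List; []; _∷_; length; reverse)
import Data.List
open import Data.List.Membership.Propositional using (_∈_)
open import Data.List.Relation.Unary.Unique.Propositional using (Unique)
open import Data.Bool using (Bool; true; false)
open import Data.Product using (Σ; ∃; ∃-syntax; _×_; _,_)
open import Data.Sum using (_⊎_)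
open import Relation.Nullary using (¬_; yes; no)
open import Relation.Binary.PropositionalEquality using (_≡_; _≢_)
open import Relation.Binary.Construct.Closure.Transitive using (TransClosure)
open import Function.Bundles using (_⇔_)

V : ℕ → Set
V n = Vec ℚ n

_+v_ : ∀ {n} → V n → V n → V n
_+v_ = zipWith _+_

_·v_ : ∀ {n} → ℚ → V n → V n
c ·v x = map (c *_) x

negv : ∀ {n} → V n → V n
negv = map (λ q → - q)

_-v_ : ∀ {n} → V n → V n → V n
x -v y = x +v negv y

0v : ∀ {n} → V n
0v = replicate _ 0ℚ

ℕtoℚ : ℕ → ℚ
ℕtoℚ k = (+ k) / 1

ℤtoℚ : ℤ → ℚ
ℤtoℚ k = k / 1

-- total division (the divisor is always nonzero where used)
_div_ : ℚ → ℚ → ℚ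
p div q with q ≟ 0ℚ
... | yes _ = 0ℚ
... | no q≢0 = _÷_ p q {{≢-nonZero q≢0}}

vsum : ∀ {n} k → (Fin k → V n) → V n
vsum zero f = 0v
vsum (suc k) f = f fzero +v vsum k (λ i → f (fsuc i))

-- Crystallographic root systems in an n-dimensional rational inner
-- product space (ℚⁿ with an arbitrary inner product ⟪_,_⟫).
-- The roots are listed injectively as root : Fin m → V n.

record RootSystem (n : ℕ) : Set where
  field
    ⟪_,_⟫      : V n → V n → ℚ
    ⟪⟫-sym     : ∀ x y → ⟪ x , y ⟫ ≡ ⟪ y , x ⟫
    ⟪⟫-+       : ∀ x y z → ⟪ x +v y , z ⟫ ≡ ⟪ x , z ⟫ + ⟪ y , z ⟫
    ⟪⟫-·       : ∀ c x z → ⟪ c ·v x , z ⟫ ≡ c * ⟪ x , z ⟫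
    ⟪⟫-posdef  : ∀ x → x ≢ 0v → 0ℚ < ⟪ x , x ⟫
    m          : ℕ
    root       : Fin m → V n
    root-inj   : ∀ i j → root i ≡ root j → i ≡ j
    root-nz    : ∀ i → root i ≢ 0v

  InΦ : V n → Set
  InΦ x = ∃[ j ] root j ≡ x

  refl-in : V n → V n → V n
  refl-in α x = x -v (((ℕtoℚ 2 * ⟪ x , α ⟫) div ⟪ α , α ⟫) ·v α)

  field
    R2 : ∀ i (c : ℚ) → InΦ (c ·v root i) → c ≡ 1ℚ ⊎ c ≡ - 1ℚ
    R3 : ∀ i j → InΦ (refl-in (root i) (root j))
    R4 : ∀ i j → ∃[ k ] ((ℕtoℚ 2 * ⟪ root j , root i ⟫) div ⟪ root i , root i ⟫) ≡ ℤtoℚ k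

open RootSystem public

Irreducible : ∀ {n} → RootSystem n → Set
Irreducible Φ = ¬ (Σ (Fin (m Φ) → Bool) λ P →
    (∃[ i ] P i ≡ true) × (∃[ j ] P j ≡ false) ×
    (∀ i j → P i ≡ true → P j ≡ false → ⟪_,_⟫ Φ (root Φ i) (root Φ j) ≡ 0ℚ))

record Base {n : ℕ} (Φ : RootSystem n) : Set where
  field
    r      : ℕ
    simple : Fin r → Fin (m Φ)

  δ : Fin r → V n
  δ i = root Φ (simple i)

  combℚ : (Fin r → ℚ) → V n
  combℚ c = vsum r (λ i → c i ·v δ i)

  combℕ : (Fin r → ℕ) → V n
  combℕ c = combℚ (λ i → ℕtoℚ (c i))

  field
    lin-indep : ∀ (c : Fin r → ℚ) → combℚ c ≡ 0v → ∀ i → c i ≡ 0ℚ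
    sign      : ∀ j → ∃[ c ] (root Φ j ≡ combℕ c ⊎ root Φ j ≡ negv (combℕ c))

open Base public

module _ {n : ℕ} {Φ : RootSystem n} (Δ : Base Φ) where

  Pos : V n → Set
  Pos x = InΦ Φ x × ∃[ c ] x ≡ combℕ Δ c

  Neg : V n → Set
  Neg x = Pos (negv x)

  _⪯_ : V n → V n → Set
  α ⪯ β = ∃[ c ] β -v α ≡ combℕ Δ c

  IsHighest : Fin (m Φ) → Set
  IsHighest γ = ∀ j → root Φ j ⪯ root Φ γ

  Inhγ : Fin (m Φ) → V n → Set
  Inhγ γ x = Pos x × x ≢ root Φ γ

  -- Elements of W: words in the reflections s_α (α ∈ Φ);
  -- the word i₁ ∷ … ∷ i_k stands for s_{α_{i₁}} ⋯ s_{α_{i_k}}.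
  W : Set
  W = List (Fin (m Φ))

  act : W → V n → V n
  act [] x = x
  act (i ∷ w) x = refl-in Φ (root Φ i) (act w x)

  -- w⁻¹ (reflections are involutions)
  inv : W → W
  inv = reverse

  _≈W_ : W → W → Set
  u ≈W v = ∀ x → act u x ≡ act v x

  s_∙_ : Fin (m Φ) → W → W
  s i ∙ w = i ∷ w

  IsLength : W → ℕ → Set
  IsLength w k =
    (Σ (List (Fin (r Δ))) λ ws → length ws ≡ k × Data.List.map (simple Δ) ws ≈W w)
    × (∀ (ws : List (Fin (r Δ))) → Data.List.map (simple Δ) ws ≈W w → k ≤ length ws)

  BruhatStep : W → W → Set
  BruhatStep u v = Σ (Fin (m Φ)) λ i →
    Pos (root Φ i) × v ≈W (s i ∙ u) × Neg (act (inv v) (root Φ i))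

  _<B_ : W → W → Set
  _<B_ = TransClosure BruhatStep

  N : W → Fin (m Φ) → Set
  N w j = Pos (root Φ j) × Neg (act (inv w) (root Φ j))

  Nγ : Fin (m Φ) → W → Fin (m Φ) → Set
  Nγ γ w j = Pos (root Φ j) × Inhγ γ (negv (act (inv w) (root Φ j)))

  HasCard : (Fin (m Φ) → Set) → ℕ → Set
  HasCard P k = Σ (List (Fin (m Φ))) λ xs →
    Unique xs × (∀ j → (j ∈ xs) ⇔ P j) × length xs ≡ k

  SameLγ : Fin (m Φ) → W → W → Set
  SameLγ γ w v = ∃[ k ] HasCard (Nγ γ w) k × HasCard (Nγ γ v) k

  IsCover : W → W → Set
  IsCover v w = Σ (Fin (m Φ)) λ i → Pos (root Φ i) × v ≈W (s i ∙ w) ×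
    ∃[ k ] IsLength w k × IsLength v (suc k)

  SameSet : (Fin (m Φ) → Set) → (Fin (m Φ) → Set) → Set
  SameSet P Q = ∀ j → P j ⇔ Q j

-- For every w, ℓ(w) = |N_w|: prepending a simple reflection to a word changes
-- the inversion count by one, and when the count is smaller than the length the
-- deletion property yields a shorter word. A Bruhat step u < s_α u strictly
-- increases |N|, because u = (s_α u) s_β with β = u⁻¹α positive and sent to a
-- negative root by s_α u. The root β_w = w(−γ) is the only element of N_w that
-- can be missing from N_w^γ, so ℓ_γ(w) is |N_w| − 1 or |N_w| according as
-- β_w ∈ N_w or not. From |N_w| < |N_v|, the equality ℓ_γ(w) = ℓ_γ(v) is then
-- equivalent to β_w ∉ N_w, β_v ∈ N_v and |N_v| = |N_w| + 1, and the last
-- condition forces the Bruhat chain from w to v to be a single step.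
module Submission where

open import Defs
open import Data.Nat as ℕ using (ℕ; zero; suc; s≤s)
import Data.Nat.Properties as ℕP
open import Data.Nat.Induction using (<-wellFounded)
open import Induction.WellFounded using (Acc; acc)
import Data.Integer as ℤ
import Data.Integer.Properties as ℤP
open import Data.Rational as ℚ using (ℚ; 0ℚ; 1ℚ; _+_; _*_; -_; _-_; _≤_; _<_)
import Data.Rational.Properties as ℚP
open import Data.Rational.Base using (≢-nonZero)
open import Data.Rational.Solver using (module +-*-Solver)
import Data.Nat.Coprimality as Coprime
open import Data.Fin as Fin using (Fin) renaming (zero to fzero; suc to fsuc)
import Data.Fin.Properties as FinP
open import Data.Vec using ([]; _∷_)
import Data.Vec.Properties as VecP
open import Data.List using (List; []; _∷_; length; map; _++_; reverse; filter; allFin)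
import Data.List.Properties as ListP
open import Data.List.Membership.Propositional using (_∈_)
open import Data.List.Membership.Propositional.Properties
  using (∈-filter⁺; ∈-filter⁻; ∈-allFin; ∈-map⁺; ∈-map⁻)
open import Data.List.Membership.Propositional.Properties.WithK using (unique∧set⇒bag)
open import Data.List.Relation.Unary.Any using (here; there)
import Data.List.Relation.Unary.All as All
open import Data.List.Relation.Unary.AllPairs using (_∷_; [])
open import Data.List.Relation.Unary.Unique.Propositional using (Unique)
import Data.List.Relation.Unary.Unique.Propositional.Properties as UniqueP
open import Data.List.Relation.Binary.BagAndSetEquality using (∼bag⇒↭)
open import Data.List.Relation.Binary.Permutation.Propositional.Properties using (↭-length)
open import Data.Product using (Σ; Σ-syntax; ∃-syntax; _×_; _,_; proj₁; proj₂)
open import Data.Sum using (_⊎_; inj₁; inj₂)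
open import Data.Empty using (⊥; ⊥-elim)
open import Relation.Nullary using (¬_; Dec; yes; no; contradiction)
open import Relation.Nullary.Decidable using (_×-dec_; ¬?)
open import Relation.Unary using (Decidable)
open import Relation.Binary.PropositionalEquality
open import Relation.Binary.Construct.Closure.Transitive using ([_]; _∷_)
open import Function using (_∘′_; case_of_)
open import Function.Bundles using (_⇔_; mk⇔; Equivalence)
open Equivalence
open +-*-Solver

ℕtoℚ-suc : ∀ k → ℕtoℚ (suc k) ≡ 1ℚ + ℕtoℚ k
ℕtoℚ-suc k rewrite ℚP.normalize-coprime (Coprime.sym (Coprime.1-coprimeTo k)) =
  cong (ℚ._/ 1) (cong (ℤ._+_ (ℤ.+ 1)) (sym (ℤP.*-identityʳ (ℤ.+ k))))

ℕtoℚ-+ : ∀ a b → ℕtoℚ (a ℕ.+ b) ≡ ℕtoℚ a + ℕtoℚ b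
ℕtoℚ-+ zero b = sym (ℚP.+-identityˡ (ℕtoℚ b))
ℕtoℚ-+ (suc a) b = begin
  ℕtoℚ (suc (a ℕ.+ b))   ≡⟨ ℕtoℚ-suc (a ℕ.+ b) ⟩
  1ℚ + ℕtoℚ (a ℕ.+ b)    ≡⟨ cong (1ℚ +_) (ℕtoℚ-+ a b) ⟩
  1ℚ + (ℕtoℚ a + ℕtoℚ b) ≡⟨ ℚP.+-assoc 1ℚ (ℕtoℚ a) (ℕtoℚ b) ⟨
  (1ℚ + ℕtoℚ a) + ℕtoℚ b ≡⟨ cong (_+ ℕtoℚ b) (ℕtoℚ-suc a) ⟨
  ℕtoℚ (suc a) + ℕtoℚ b  ∎
  where open ≡-Reasoning

ℕtoℚ-nonneg : ∀ a → 0ℚ ≤ ℕtoℚ a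
ℕtoℚ-nonneg zero = ℚP.≤-refl
ℕtoℚ-nonneg (suc a) = subst (0ℚ ≤_) (sym (ℕtoℚ-suc a))
  (ℚP.+-mono-≤ (ℚP.nonNegative⁻¹ 1ℚ) (ℕtoℚ-nonneg a))

ℕtoℚ-mono-≤ : ∀ {a b} → a ℕ.≤ b → ℕtoℚ a ≤ ℕtoℚ b
ℕtoℚ-mono-≤ {a} a≤b with ℕP.m≤n⇒∃[o]m+o≡n a≤b
... | d , refl = subst₂ _≤_ (ℚP.+-identityʳ (ℕtoℚ a)) (sym (ℕtoℚ-+ a d))
  (ℚP.+-monoʳ-≤ (ℕtoℚ a) (ℕtoℚ-nonneg d))

ℕtoℚ-cancel-< : ∀ {a b} → ℕtoℚ a < ℕtoℚ b → a ℕ.< b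
ℕtoℚ-cancel-< {a} {b} a<b = ℕP.≰⇒> λ b≤a → ℚP.<-irrefl refl (ℚP.<-≤-trans a<b (ℕtoℚ-mono-≤ b≤a))

p-q≡0⇒p≡q : ∀ p q → p - q ≡ 0ℚ → p ≡ q
p-q≡0⇒p≡q p q e = begin
  p             ≡⟨ solve 2 (λ p q → p := (p :- q) :+ q) refl p q ⟩
  (p - q) + q   ≡⟨ cong (_+ q) e ⟩
  0ℚ + q        ≡⟨ ℚP.+-identityˡ q ⟩
  q             ∎
  where open ≡-Reasoning

nonneg+nonneg≡0⇒≡0 : ∀ p q → 0ℚ ≤ p → 0ℚ ≤ q → p + q ≡ 0ℚ → p ≡ 0ℚ
nonneg+nonneg≡0⇒≡0 p q 0≤p 0≤q p+q≡0 = ℚP.≤-antisym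
  (subst₂ _≤_ (ℚP.+-identityʳ p) p+q≡0 (ℚP.+-monoʳ-≤ p 0≤q)) 0≤p

p-q<p : ∀ p q → 0ℚ < q → p - q < p
p-q<p p q 0<q = subst (p - q <_) (ℚP.+-identityʳ p) (ℚP.+-monoʳ-< p (ℚP.neg-antimono-< 0<q))

nonneg≢-1 : ∀ p → 0ℚ ≤ p → p ≢ - 1ℚ
nonneg≢-1 p 0≤p refl = ℚP.<-irrefl refl (ℚP.≤-<-trans 0≤p (ℚP.negative⁻¹ (- 1ℚ)))

recip : ℚ → ℚ
recip q = 1ℚ div q

div≡*recip : ∀ p q → p div q ≡ p * recip q
div≡*recip p q with q ℚP.≟ 0ℚ
... | yes _ = sym (ℚP.*-zeroʳ p)
... | no _ = cong (p *_) (sym (ℚP.*-identityˡ _))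

-- recip 0 = 0, so only the weak inverse law holds unconditionally
recip-cases : ∀ q → (q ≡ 0ℚ × recip q ≡ 0ℚ) ⊎ (q ≢ 0ℚ × q * recip q ≡ 1ℚ)
recip-cases q with q ℚP.≟ 0ℚ
... | yes q≡0 = inj₁ (q≡0 , refl)
... | no q≢0 = inj₂ (q≢0 , trans (cong (q *_) (ℚP.*-identityˡ (ℚ.1/_ q {{≢-nonZero q≢0}})))
                                 (ℚP.*-inverseʳ q {{≢-nonZero q≢0}}))

recip-weak-inverse : ∀ q → recip q * (q * recip q) ≡ recip q
recip-weak-inverse q with recip-cases q
... | inj₁ (_ , e) rewrite e = ℚP.*-zeroˡ (q * 0ℚ)
... | inj₂ (_ , e) = trans (cong (recip q *_) e) (ℚP.*-identityʳ (recip q))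

*-recip : ∀ q → q ≢ 0ℚ → q * recip q ≡ 1ℚ
*-recip q q≢0 with recip-cases q
... | inj₁ (q≡0 , _) = contradiction q≡0 q≢0
... | inj₂ (_ , e) = e

recip-pos : ∀ q → 0ℚ < q → 0ℚ < recip q
recip-pos q 0<q with recip-cases q
... | inj₁ (q≡0 , _) = contradiction (sym q≡0) (ℚP.<⇒≢ 0<q)
... | inj₂ (_ , e) = ℚP.≰⇒> λ r≤0 → ℚP.<-irrefl refl (ℚP.<-≤-trans (ℚP.positive⁻¹ 1ℚ)
  (subst₂ _≤_ e (ℚP.*-zeroʳ q) (ℚP.*-monoˡ-≤-nonNeg q {{ℚ.nonNegative (ℚP.<⇒≤ 0<q)}} r≤0)))

*-pos : ∀ p q → 0ℚ < p → 0ℚ < q → 0ℚ < p * q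
*-pos p q 0<p 0<q = ℚP.positive⁻¹ (p * q)
  {{ℚP.pos*pos⇒pos p {{ℚ.positive 0<p}} q {{ℚ.positive 0<q}}}}

+v-identityˡ : ∀ {n} (x : V n) → 0v +v x ≡ x
+v-identityˡ [] = refl
+v-identityˡ (x ∷ xs) = cong₂ _∷_ (ℚP.+-identityˡ x) (+v-identityˡ xs)

+v-identityʳ : ∀ {n} (x : V n) → x +v 0v ≡ x
+v-identityʳ [] = refl
+v-identityʳ (x ∷ xs) = cong₂ _∷_ (ℚP.+-identityʳ x) (+v-identityʳ xs)

-v-self : ∀ {n} (x : V n) → x -v x ≡ 0v
-v-self [] = refl
-v-self (x ∷ xs) = cong₂ _∷_ (ℚP.+-inverseʳ x) (-v-self xs)

negv-involutive : ∀ {n} (x : V n) → negv (negv x) ≡ x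
negv-involutive [] = refl
negv-involutive (x ∷ xs) = cong₂ _∷_ (solve 1 (λ x → :- (:- x) := x) refl x) (negv-involutive xs)

negv≡-1·v : ∀ {n} (x : V n) → negv x ≡ (- 1ℚ) ·v x
negv≡-1·v [] = refl
negv≡-1·v (x ∷ xs) = cong₂ _∷_ (solve 1 (λ x → :- x := (:- con 1ℚ) :* x) refl x) (negv≡-1·v xs)

·v-zeroˡ : ∀ {n} (x : V n) → 0ℚ ·v x ≡ 0v
·v-zeroˡ [] = refl
·v-zeroˡ (x ∷ xs) = cong₂ _∷_ (ℚP.*-zeroˡ x) (·v-zeroˡ xs)

·v-zeroʳ : ∀ {n} p → p ·v (0v {n}) ≡ 0v
·v-zeroʳ {zero} p = refl
·v-zeroʳ {suc n} p = cong₂ _∷_ (ℚP.*-zeroʳ p) (·v-zeroʳ {n} p)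

·v-identityˡ : ∀ {n} (x : V n) → 1ℚ ·v x ≡ x
·v-identityˡ [] = refl
·v-identityˡ (x ∷ xs) = cong₂ _∷_ (ℚP.*-identityˡ x) (·v-identityˡ xs)

·v-distribʳ-+ : ∀ {n} (x : V n) p q → (p + q) ·v x ≡ (p ·v x) +v (q ·v x)
·v-distribʳ-+ [] p q = refl
·v-distribʳ-+ (x ∷ xs) p q = cong₂ _∷_ (ℚP.*-distribʳ-+ x p q) (·v-distribʳ-+ xs p q)

·v-distribʳ-- : ∀ {n} (x : V n) p q → (p - q) ·v x ≡ (p ·v x) -v (q ·v x)
·v-distribʳ-- [] p q = refl
·v-distribʳ-- (x ∷ xs) p q = cong₂ _∷_
  (solve 3 (λ x p q → (p :- q) :* x := (p :* x) :- (q :* x)) refl x p q) (·v-distribʳ-- xs p q)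

+v-interchange : ∀ {n} (a b c d : V n) → (a +v b) +v (c +v d) ≡ (a +v c) +v (b +v d)
+v-interchange [] [] [] [] = refl
+v-interchange (a ∷ as) (b ∷ bs) (c ∷ cs) (d ∷ ds) = cong₂ _∷_
  (solve 4 (λ a b c d → (a :+ b) :+ (c :+ d) := (a :+ c) :+ (b :+ d)) refl a b c d)
  (+v-interchange as bs cs ds)

-v-interchange : ∀ {n} (a b c d : V n) → (a -v b) +v (c -v d) ≡ (a +v c) -v (b +v d)
-v-interchange [] [] [] [] = refl
-v-interchange (a ∷ as) (b ∷ bs) (c ∷ cs) (d ∷ ds) = cong₂ _∷_
  (solve 4 (λ a b c d → (a :- b) :+ (c :- d) := (a :+ c) :- (b :+ d)) refl a b c d)
  (-v-interchange as bs cs ds)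

-·v-split : ∀ {n} (x y a : V n) p q →
  (x +v y) -v ((p + q) ·v a) ≡ (x -v (p ·v a)) +v (y -v (q ·v a))
-·v-split [] [] [] p q = refl
-·v-split (x ∷ xs) (y ∷ ys) (a ∷ as) p q = cong₂ _∷_
  (solve 5 (λ x y a p q → (x :+ y) :- ((p :+ q) :* a) := (x :- (p :* a)) :+ (y :- (q :* a))) refl x y a p q)
  (-·v-split xs ys as p q)

-·v-scale : ∀ {n} (x a : V n) k p → (k ·v x) -v ((k * p) ·v a) ≡ k ·v (x -v (p ·v a))
-·v-scale [] [] k p = refl
-·v-scale (x ∷ xs) (a ∷ as) k p = cong₂ _∷_
  (solve 4 (λ x a k p → (k :* x) :- ((k :* p) :* a) := k :* (x :- (p :* a))) refl x a k p)
  (-·v-scale xs as k p)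

-·v-twice : ∀ {n} (x a : V n) p q → (x -v (p ·v a)) -v (q ·v a) ≡ x -v ((p + q) ·v a)
-·v-twice [] [] p q = refl
-·v-twice (x ∷ xs) (a ∷ as) p q = cong₂ _∷_
  (solve 4 (λ x a p q → (x :- (p :* a)) :- (q :* a) := x :- ((p :+ q) :* a)) refl x a p q)
  (-·v-twice xs as p q)

-·v-zero : ∀ {n} (x a : V n) → x -v (0ℚ ·v a) ≡ x
-·v-zero [] [] = refl
-·v-zero (x ∷ xs) (a ∷ as) = cong₂ _∷_ (solve 2 (λ x a → x :- (con 0ℚ :* a) := x) refl x a) (-·v-zero xs as)

-·v-two-self : ∀ {n} (x : V n) → x -v ((1ℚ + 1ℚ) ·v x) ≡ negv x
-·v-two-self [] = refl
-·v-two-self (x ∷ xs) = cong₂ _∷_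
  (solve 1 (λ x → x :- ((con 1ℚ :+ con 1ℚ) :* x) := :- x) refl x) (-·v-two-self xs)

neg·v-negv : ∀ {n} (a : V n) p → (- p) ·v negv a ≡ p ·v a
neg·v-negv [] p = refl
neg·v-negv (a ∷ as) p = cong₂ _∷_ (solve 2 (λ a p → (:- p) :* (:- a) := p :* a) refl a p) (neg·v-negv as p)


Σℚ : ∀ k → (Fin k → ℚ) → ℚ
Σℚ zero f = 0ℚ
Σℚ (suc k) f = f fzero + Σℚ k (λ i → f (fsuc i))

Σℕ : ∀ k → (Fin k → ℕ) → ℕ
Σℕ zero f = 0
Σℕ (suc k) f = f fzero ℕ.+ Σℕ k (λ i → f (fsuc i))

kron : ∀ {k} → Fin k → Fin k → ℚ → ℚ
kron fzero fzero p = p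
kron fzero (fsuc j) p = 0ℚ
kron (fsuc i) fzero p = 0ℚ
kron (fsuc i) (fsuc j) p = kron i j p

kronℕ : ∀ {k} → Fin k → Fin k → ℕ
kronℕ fzero fzero = 1
kronℕ fzero (fsuc j) = 0
kronℕ (fsuc i) fzero = 0
kronℕ (fsuc i) (fsuc j) = kronℕ i j

kron-diag : ∀ {k} (i : Fin k) p → kron i i p ≡ p
kron-diag fzero p = refl
kron-diag (fsuc i) p = kron-diag i p

kron-offdiag : ∀ {k} (i j : Fin k) p → i ≢ j → kron i j p ≡ 0ℚ
kron-offdiag fzero fzero p i≢j = contradiction refl i≢j
kron-offdiag fzero (fsuc j) p i≢j = refl
kron-offdiag (fsuc i) fzero p i≢j = refl
kron-offdiag (fsuc i) (fsuc j) p i≢j = kron-offdiag i j p (i≢j ∘′ cong fsuc)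

ℕtoℚ-kronℕ : ∀ {k} (i j : Fin k) → ℕtoℚ (kronℕ i j) ≡ kron i j 1ℚ
ℕtoℚ-kronℕ fzero fzero = refl
ℕtoℚ-kronℕ fzero (fsuc j) = refl
ℕtoℚ-kronℕ (fsuc i) fzero = refl
ℕtoℚ-kronℕ (fsuc i) (fsuc j) = ℕtoℚ-kronℕ i j

Σℚ-cong : ∀ k {f g : Fin k → ℚ} → (∀ i → f i ≡ g i) → Σℚ k f ≡ Σℚ k g
Σℚ-cong zero f≗g = refl
Σℚ-cong (suc k) f≗g = cong₂ _+_ (f≗g fzero) (Σℚ-cong k (λ i → f≗g (fsuc i)))

Σℚ-distrib-- : ∀ k (f g : Fin k → ℚ) → Σℚ k (λ i → f i - g i) ≡ Σℚ k f - Σℚ k g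
Σℚ-distrib-- zero f g = refl
Σℚ-distrib-- (suc k) f g = trans (cong (f fzero - g fzero +_) (Σℚ-distrib-- k _ _))
  (solve 4 (λ a b c d → (a :- b) :+ (c :- d) := (a :+ c) :- (b :+ d)) refl
    (f fzero) (g fzero) (Σℚ k (λ i → f (fsuc i))) (Σℚ k (λ i → g (fsuc i))))

Σℚ-zero : ∀ k → Σℚ k (λ _ → 0ℚ) ≡ 0ℚ
Σℚ-zero zero = refl
Σℚ-zero (suc k) = trans (ℚP.+-identityˡ _) (Σℚ-zero k)

Σℚ-kron : ∀ k (i : Fin k) p → Σℚ k (λ j → kron i j p) ≡ p
Σℚ-kron (suc k) fzero p = trans (cong (p +_) (Σℚ-zero k)) (ℚP.+-identityʳ p)
Σℚ-kron (suc k) (fsuc i) p = trans (ℚP.+-identityˡ _) (Σℚ-kron k i p)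

ℕtoℚ-Σℕ : ∀ k (f : Fin k → ℕ) → ℕtoℚ (Σℕ k f) ≡ Σℚ k (λ i → ℕtoℚ (f i))
ℕtoℚ-Σℕ zero f = refl
ℕtoℚ-Σℕ (suc k) f = trans (ℕtoℚ-+ (f fzero) _) (cong (ℕtoℚ (f fzero) +_) (ℕtoℚ-Σℕ k (λ i → f (fsuc i))))

Σℚ-nonpos : ∀ k (f : Fin k → ℚ) → (∀ i → f i ≤ 0ℚ) → Σℚ k f ≤ 0ℚ
Σℚ-nonpos zero f f≤0 = ℚP.≤-refl
Σℚ-nonpos (suc k) f f≤0 = subst (Σℚ (suc k) f ≤_) (ℚP.+-identityˡ 0ℚ)
  (ℚP.+-mono-≤ (f≤0 fzero) (Σℚ-nonpos k _ (λ i → f≤0 (fsuc i))))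

vsum-cong : ∀ {n} k {f g : Fin k → V n} → (∀ i → f i ≡ g i) → vsum k f ≡ vsum k g
vsum-cong zero f≗g = refl
vsum-cong (suc k) f≗g = cong₂ _+v_ (f≗g fzero) (vsum-cong k (λ i → f≗g (fsuc i)))

vsum-zero : ∀ {n} k → vsum {n} k (λ _ → 0v) ≡ 0v
vsum-zero zero = refl
vsum-zero (suc k) = trans (+v-identityˡ _) (vsum-zero k)

vsum-distrib-+ : ∀ {n} k (f g : Fin k → V n) → vsum k (λ i → f i +v g i) ≡ vsum k f +v vsum k g
vsum-distrib-+ zero f g = sym (+v-identityˡ 0v)
vsum-distrib-+ (suc k) f g = trans (cong ((f fzero +v g fzero) +v_) (vsum-distrib-+ k _ _)) (+v-interchange _ _ _ _)

vsum-distrib-- : ∀ {n} k (f g : Fin k → V n) → vsum k (λ i → f i -v g i) ≡ vsum k f -v vsum k g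
vsum-distrib-- zero f g = sym (-v-self 0v)
vsum-distrib-- (suc k) f g = trans (cong ((f fzero -v g fzero) +v_) (vsum-distrib-- k _ _)) (-v-interchange _ _ _ _)

vsum-kron : ∀ {n} k (i : Fin k) (f : Fin k → V n) p → vsum k (λ j → kron i j p ·v f j) ≡ p ·v f i
vsum-kron (suc k) fzero f p =
  trans (cong ((p ·v f fzero) +v_) (trans (vsum-cong k (λ j → ·v-zeroˡ (f (fsuc j)))) (vsum-zero k)))
        (+v-identityʳ _)
vsum-kron (suc k) (fsuc i) f p =
  trans (cong (_+v vsum k (λ j → kron i j p ·v f (fsuc j))) (·v-zeroˡ (f fzero)))
        (trans (+v-identityˡ _) (vsum-kron k i (λ j → f (fsuc j)) p))

two : ℚ
two = 1ℚ + 1ℚ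

module Reflections {n : ℕ} (Φ : RootSystem n) where
  open RootSystem Φ using ()
    renaming (⟪_,_⟫ to ⟨_,_⟩; ⟪⟫-sym to ⟨⟩-sym; ⟪⟫-+ to ⟨⟩-+ˡ; ⟪⟫-· to ⟨⟩-·ˡ)

  ⟨⟩-+ʳ : ∀ z x y → ⟨ z , x +v y ⟩ ≡ ⟨ z , x ⟩ + ⟨ z , y ⟩
  ⟨⟩-+ʳ z x y = trans (⟨⟩-sym z _) (trans (⟨⟩-+ˡ x y z) (cong₂ _+_ (⟨⟩-sym x z) (⟨⟩-sym y z)))

  ⟨⟩-·ʳ : ∀ z c x → ⟨ z , c ·v x ⟩ ≡ c * ⟨ z , x ⟩
  ⟨⟩-·ʳ z c x = trans (⟨⟩-sym z _) (trans (⟨⟩-·ˡ c x z) (cong (c *_) (⟨⟩-sym x z)))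

  ⟨⟩-negˡ : ∀ x z → ⟨ negv x , z ⟩ ≡ - ⟨ x , z ⟩
  ⟨⟩-negˡ x z = trans (cong ⟨_, z ⟩ (negv≡-1·v x)) (trans (⟨⟩-·ˡ (- 1ℚ) x z)
    (solve 1 (λ a → (:- con 1ℚ) :* a := :- a) refl ⟨ x , z ⟩))

  ⟨⟩-negʳ : ∀ z x → ⟨ z , negv x ⟩ ≡ - ⟨ z , x ⟩
  ⟨⟩-negʳ z x = trans (⟨⟩-sym z _) (trans (⟨⟩-negˡ x z) (cong -_ (⟨⟩-sym x z)))

  ⟨⟩--ˡ : ∀ x y z → ⟨ x -v y , z ⟩ ≡ ⟨ x , z ⟩ - ⟨ y , z ⟩
  ⟨⟩--ˡ x y z = trans (⟨⟩-+ˡ x (negv y) z) (cong (⟨ x , z ⟩ +_) (⟨⟩-negˡ y z))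

  ⟨⟩--ʳ : ∀ z x y → ⟨ z , x -v y ⟩ ≡ ⟨ z , x ⟩ - ⟨ z , y ⟩
  ⟨⟩--ʳ z x y = trans (⟨⟩-+ʳ z x (negv y)) (cong (⟨ z , x ⟩ +_) (⟨⟩-negʳ z y))

  ⟨⟩-zeroˡ : ∀ z → ⟨ 0v , z ⟩ ≡ 0ℚ
  ⟨⟩-zeroˡ z = trans (cong ⟨_, z ⟩ (sym (·v-zeroʳ {n} 0ℚ))) (trans (⟨⟩-·ˡ 0ℚ 0v z) (ℚP.*-zeroˡ ⟨ 0v , z ⟩))

  ⟨⟩-vsumˡ : ∀ k (f : Fin k → V n) z → ⟨ vsum k f , z ⟩ ≡ Σℚ k (λ i → ⟨ f i , z ⟩)
  ⟨⟩-vsumˡ zero f z = ⟨⟩-zeroˡ z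
  ⟨⟩-vsumˡ (suc k) f z = trans (⟨⟩-+ˡ _ _ z) (cong (⟨ f fzero , z ⟩ +_) (⟨⟩-vsumˡ k _ z))

  private
    T : ∀ {k} → Polynomial k
    T = con 1ℚ :+ con 1ℚ

  ⟨_,_∨⟩ : V n → V n → ℚ
  ⟨ x , a ∨⟩ = (two * ⟨ x , a ⟩) * recip ⟨ a , a ⟩

  s : V n → V n → V n
  s = refl-in Φ

  s-def : ∀ a x → s a x ≡ x -v (⟨ x , a ∨⟩ ·v a)
  s-def a x = cong (λ c → x -v (c ·v a)) (div≡*recip (ℕtoℚ 2 * ⟨ x , a ⟩) ⟨ a , a ⟩)

  ∨-+ : ∀ a x y → ⟨ x +v y , a ∨⟩ ≡ ⟨ x , a ∨⟩ + ⟨ y , a ∨⟩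
  ∨-+ a x y = trans (cong (λ z → (two * z) * recip ⟨ a , a ⟩) (⟨⟩-+ˡ x y a))
    (solve 4 (λ t X Y i → (t :* (X :+ Y)) :* i := (t :* X) :* i :+ (t :* Y) :* i) refl
      two ⟨ x , a ⟩ ⟨ y , a ⟩ (recip ⟨ a , a ⟩))

  ∨-· : ∀ a k x → ⟨ k ·v x , a ∨⟩ ≡ k * ⟨ x , a ∨⟩
  ∨-· a k x = trans (cong (λ z → (two * z) * recip ⟨ a , a ⟩) (⟨⟩-·ˡ k x a))
    (solve 4 (λ t k X i → (t :* (k :* X)) :* i := k :* ((t :* X) :* i)) refl
      two k ⟨ x , a ⟩ (recip ⟨ a , a ⟩))

  s-+ : ∀ a x y → s a (x +v y) ≡ s a x +v s a y
  s-+ a x y = begin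
    s a (x +v y)                                            ≡⟨ s-def a _ ⟩
    (x +v y) -v (⟨ x +v y , a ∨⟩ ·v a)                      ≡⟨ cong (λ c → (x +v y) -v (c ·v a)) (∨-+ a x y) ⟩
    (x +v y) -v ((⟨ x , a ∨⟩ + ⟨ y , a ∨⟩) ·v a)            ≡⟨ -·v-split x y a ⟨ x , a ∨⟩ ⟨ y , a ∨⟩ ⟩
    (x -v (⟨ x , a ∨⟩ ·v a)) +v (y -v (⟨ y , a ∨⟩ ·v a))    ≡⟨ cong₂ _+v_ (s-def a x) (s-def a y) ⟨
    s a x +v s a y                                          ∎
    where open ≡-Reasoning

  s-· : ∀ a k x → s a (k ·v x) ≡ k ·v s a x
  s-· a k x = begin
    s a (k ·v x)                              ≡⟨ s-def a _ ⟩
    (k ·v x) -v (⟨ k ·v x , a ∨⟩ ·v a)        ≡⟨ cong (λ c → (k ·v x) -v (c ·v a)) (∨-· a k x) ⟩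
    (k ·v x) -v ((k * ⟨ x , a ∨⟩) ·v a)       ≡⟨ -·v-scale x a k ⟨ x , a ∨⟩ ⟩
    k ·v (x -v (⟨ x , a ∨⟩ ·v a))             ≡⟨ cong (k ·v_) (s-def a x) ⟨
    k ·v s a x                                ∎
    where open ≡-Reasoning

  s-negv : ∀ a x → s a (negv x) ≡ negv (s a x)
  s-negv a x = trans (cong (s a) (negv≡-1·v x)) (trans (s-· a (- 1ℚ) x) (sym (negv≡-1·v _)))

  s-- : ∀ a x y → s a (x -v y) ≡ s a x -v s a y
  s-- a x y = trans (s-+ a x (negv y)) (cong (s a x +v_) (s-negv a y))

  s-isometry : ∀ a x y → ⟨ s a x , s a y ⟩ ≡ ⟨ x , y ⟩
  s-isometry a x y = begin
    ⟨ s a x , s a y ⟩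
      ≡⟨ cong₂ ⟨_,_⟩ (s-def a x) (s-def a y) ⟩
    ⟨ x -v (cx ·v a) , y -v (cy ·v a) ⟩
      ≡⟨ ⟨⟩--ˡ x _ _ ⟩
    ⟨ x , y -v (cy ·v a) ⟩ - ⟨ cx ·v a , y -v (cy ·v a) ⟩
      ≡⟨ cong₂ _-_ (⟨⟩--ʳ x y (cy ·v a)) (⟨⟩-·ˡ cx a (y -v (cy ·v a))) ⟩
    (⟨ x , y ⟩ - ⟨ x , cy ·v a ⟩) - cx * ⟨ a , y -v (cy ·v a) ⟩
      ≡⟨ cong₂ (λ u v → (⟨ x , y ⟩ - u) - cx * v) (⟨⟩-·ʳ x cy a) (⟨⟩--ʳ a y (cy ·v a)) ⟩
    (⟨ x , y ⟩ - cy * ⟨ x , a ⟩) - cx * (⟨ a , y ⟩ - ⟨ a , cy ·v a ⟩)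
      ≡⟨ cong₂ (λ u v → (⟨ x , y ⟩ - cy * ⟨ x , a ⟩) - cx * (u - v)) (⟨⟩-sym a y) (⟨⟩-·ʳ a cy a) ⟩
    (⟨ x , y ⟩ - cy * ⟨ x , a ⟩) - cx * (⟨ y , a ⟩ - cy * ⟨ a , a ⟩)
      ≡⟨ identity ⟨ x , y ⟩ ⟨ x , a ⟩ ⟨ y , a ⟩ ⟨ a , a ⟩ (recip ⟨ a , a ⟩) (recip-weak-inverse ⟨ a , a ⟩) ⟩
    ⟨ x , y ⟩ ∎
    where
    open ≡-Reasoning
    cx cy : ℚ
    cx = ⟨ x , a ∨⟩
    cy = ⟨ y , a ∨⟩
    identity : ∀ P X Y A i → i * (A * i) ≡ i →
      (P - ((two * Y) * i) * X) - ((two * X) * i) * (Y - ((two * Y) * i) * A) ≡ P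
    identity P X Y A i i*A*i≡i = begin
      (P - ((two * Y) * i) * X) - ((two * X) * i) * (Y - ((two * Y) * i) * A)
        ≡⟨ solve 5 (λ P X Y A i →
             (P :- ((T :* Y) :* i) :* X) :- ((T :* X) :* i) :* (Y :- ((T :* Y) :* i) :* A)
             := P :- T :* T :* X :* Y :* i :+ T :* T :* X :* Y :* (i :* (A :* i))) refl P X Y A i ⟩
      P - two * two * X * Y * i + two * two * X * Y * (i * (A * i))
        ≡⟨ cong (λ z → P - two * two * X * Y * i + two * two * X * Y * z) i*A*i≡i ⟩
      P - two * two * X * Y * i + two * two * X * Y * i
        ≡⟨ solve 4 (λ P X Y i → P :- T :* T :* X :* Y :* i :+ T :* T :* X :* Y :* i := P) refl P X Y i ⟩
      P ∎

  s-involutive : ∀ a x → s a (s a x) ≡ x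
  s-involutive a x = begin
    s a (s a x)                                         ≡⟨ s-def a _ ⟩
    s a x -v (⟨ s a x , a ∨⟩ ·v a)                      ≡⟨ cong (_-v (⟨ s a x , a ∨⟩ ·v a)) (s-def a x) ⟩
    (x -v (⟨ x , a ∨⟩ ·v a)) -v (⟨ s a x , a ∨⟩ ·v a)   ≡⟨ -·v-twice x a ⟨ x , a ∨⟩ ⟨ s a x , a ∨⟩ ⟩
    x -v ((⟨ x , a ∨⟩ + ⟨ s a x , a ∨⟩) ·v a)           ≡⟨ cong (λ c → x -v (c ·v a)) coeffs-cancel ⟩
    x -v (0ℚ ·v a)                                      ≡⟨ -·v-zero x a ⟩
    x                                                   ∎
    where
    open ≡-Reasoning
    ⟨sx,a⟩ : ⟨ s a x , a ⟩ ≡ ⟨ x , a ⟩ - ⟨ x , a ∨⟩ * ⟨ a , a ⟩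
    ⟨sx,a⟩ = trans (cong ⟨_, a ⟩ (s-def a x))
      (trans (⟨⟩--ˡ x _ a) (cong (λ z → ⟨ x , a ⟩ - z) (⟨⟩-·ˡ ⟨ x , a ∨⟩ a a)))
    identity : ∀ X A i → i * (A * i) ≡ i → (two * X) * i + (two * (X - ((two * X) * i) * A)) * i ≡ 0ℚ
    identity X A i i*A*i≡i = begin
      (two * X) * i + (two * (X - ((two * X) * i) * A)) * i
        ≡⟨ solve 3 (λ X A i → (T :* X) :* i :+ (T :* (X :- ((T :* X) :* i) :* A)) :* i
             := T :* T :* X :* i :- T :* T :* X :* (i :* (A :* i))) refl X A i ⟩
      two * two * X * i - two * two * X * (i * (A * i)) ≡⟨ cong (λ z → two * two * X * i - two * two * X * z) i*A*i≡i ⟩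
      two * two * X * i - two * two * X * i             ≡⟨ ℚP.+-inverseʳ (two * two * X * i) ⟩
      0ℚ                                                ∎
    coeffs-cancel : ⟨ x , a ∨⟩ + ⟨ s a x , a ∨⟩ ≡ 0ℚ
    coeffs-cancel = trans (cong (λ z → ⟨ x , a ∨⟩ + (two * z) * recip ⟨ a , a ⟩) ⟨sx,a⟩)
      (identity ⟨ x , a ⟩ ⟨ a , a ⟩ (recip ⟨ a , a ⟩) (recip-weak-inverse ⟨ a , a ⟩))

  s-self : ∀ a → a ≢ 0v → s a a ≡ negv a
  s-self a a≢0 = begin
    s a a                       ≡⟨ s-def a a ⟩
    a -v (⟨ a , a ∨⟩ ·v a)      ≡⟨ cong (λ c → a -v (c ·v a)) ⟨a,a∨⟩≡2 ⟩
    a -v (two ·v a)             ≡⟨ -·v-two-self a ⟩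
    negv a                      ∎
    where
    open ≡-Reasoning
    ⟨a,a⟩≢0 : ⟨ a , a ⟩ ≢ 0ℚ
    ⟨a,a⟩≢0 e = ℚP.<-irrefl (sym e) (⟪⟫-posdef Φ a a≢0)
    ⟨a,a∨⟩≡2 : ⟨ a , a ∨⟩ ≡ two
    ⟨a,a∨⟩≡2 = trans (ℚP.*-assoc two ⟨ a , a ⟩ _)
      (trans (cong (two *_) (*-recip ⟨ a , a ⟩ ⟨a,a⟩≢0)) (ℚP.*-identityʳ two))

  ∨-s : ∀ b a x → ⟨ s b x , s b a ∨⟩ ≡ ⟨ x , a ∨⟩
  ∨-s b a x = cong₂ (λ u v → (two * u) * recip v) (s-isometry b x a) (s-isometry b a a)

  s-conj : ∀ b a x → s b (s a x) ≡ s (s b a) (s b x)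
  s-conj b a x = begin
    s b (s a x)                                  ≡⟨ cong (s b) (s-def a x) ⟩
    s b (x -v (⟨ x , a ∨⟩ ·v a))                 ≡⟨ s-- b x _ ⟩
    s b x -v s b (⟨ x , a ∨⟩ ·v a)               ≡⟨ cong (s b x -v_) (s-· b ⟨ x , a ∨⟩ a) ⟩
    s b x -v (⟨ x , a ∨⟩ ·v s b a)               ≡⟨ cong (λ c → s b x -v (c ·v s b a)) (∨-s b a x) ⟨
    s b x -v (⟨ s b x , s b a ∨⟩ ·v s b a)       ≡⟨ s-def (s b a) (s b x) ⟨
    s (s b a) (s b x)                            ∎
    where open ≡-Reasoning

  s-negv-root : ∀ a x → s (negv a) x ≡ s a x
  s-negv-root a x = begin
    s (negv a) x                          ≡⟨ s-def (negv a) x ⟩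
    x -v (⟨ x , negv a ∨⟩ ·v negv a)      ≡⟨ cong (λ c → x -v (c ·v negv a)) ∨-negv ⟩
    x -v ((- ⟨ x , a ∨⟩) ·v negv a)       ≡⟨ cong (x -v_) (neg·v-negv a ⟨ x , a ∨⟩) ⟩
    x -v (⟨ x , a ∨⟩ ·v a)                ≡⟨ s-def a x ⟨
    s a x                                 ∎
    where
    open ≡-Reasoning
    ⟨-a,-a⟩ : ⟨ negv a , negv a ⟩ ≡ ⟨ a , a ⟩
    ⟨-a,-a⟩ = trans (⟨⟩-negˡ a _) (trans (cong -_ (⟨⟩-negʳ a a)) (solve 1 (λ z → :- (:- z) := z) refl ⟨ a , a ⟩))
    ∨-negv : ⟨ x , negv a ∨⟩ ≡ - ⟨ x , a ∨⟩
    ∨-negv = trans (cong₂ (λ u v → (two * u) * recip v) (⟨⟩-negʳ x a) ⟨-a,-a⟩)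
      (solve 3 (λ t X i → (t :* (:- X)) :* i := :- ((t :* X) :* i)) refl two ⟨ x , a ⟩ (recip ⟨ a , a ⟩))

module Roots {n : ℕ} {Φ : RootSystem n} (Δ : Base Φ) where
  open Reflections Φ

  comb-cong : ∀ {a b : Fin (r Δ) → ℚ} → (∀ i → a i ≡ b i) → combℚ Δ a ≡ combℚ Δ b
  comb-cong a≗b = vsum-cong (r Δ) (λ i → cong (_·v δ Δ i) (a≗b i))

  comb-distrib-+ : ∀ a b → combℚ Δ (λ i → a i + b i) ≡ combℚ Δ a +v combℚ Δ b
  comb-distrib-+ a b = trans (vsum-cong (r Δ) (λ i → ·v-distribʳ-+ (δ Δ i) (a i) (b i))) (vsum-distrib-+ (r Δ) _ _)

  comb-distrib-- : ∀ a b → combℚ Δ (λ i → a i - b i) ≡ combℚ Δ a -v combℚ Δ b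
  comb-distrib-- a b = trans (vsum-cong (r Δ) (λ i → ·v-distribʳ-- (δ Δ i) (a i) (b i))) (vsum-distrib-- (r Δ) _ _)

  comb-zero : combℚ Δ (λ _ → 0ℚ) ≡ 0v
  comb-zero = trans (vsum-cong (r Δ) (λ i → ·v-zeroˡ (δ Δ i))) (vsum-zero (r Δ))

  comb-kron : ∀ i p → combℚ Δ (λ j → kron i j p) ≡ p ·v δ Δ i
  comb-kron i p = vsum-kron (r Δ) i (δ Δ) p

  comb-injective : ∀ a b → combℚ Δ a ≡ combℚ Δ b → ∀ i → a i ≡ b i
  comb-injective a b e i = p-q≡0⇒p≡q (a i) (b i) (lin-indep Δ (λ j → a j - b j)
    (trans (comb-distrib-- a b) (trans (cong (_-v combℚ Δ b) e) (-v-self (combℚ Δ b)))) i)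

  comb≡0⇒≡0 : ∀ a → combℚ Δ a ≡ 0v → ∀ i → a i ≡ 0ℚ
  comb≡0⇒≡0 a e = comb-injective a (λ _ → 0ℚ) (trans e (sym comb-zero))

  ⟨comb,⟩ : ∀ a z → ⟪_,_⟫ Φ (combℚ Δ a) z ≡ Σℚ (r Δ) (λ i → a i * ⟪_,_⟫ Φ (δ Δ i) z)
  ⟨comb,⟩ a z = trans (⟨⟩-vsumˡ (r Δ) _ z) (Σℚ-cong (r Δ) (λ i → ⟪⟫-· Φ (a i) (δ Δ i) z))

  InΦ⇒≢0 : ∀ {x} → InΦ Φ x → x ≢ 0v
  InΦ⇒≢0 (j , refl) = root-nz Φ j

  InΦ-s : ∀ {a x} → InΦ Φ a → InΦ Φ x → InΦ Φ (s a x)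
  InΦ-s (i , refl) (j , refl) = R3 Φ i j

  InΦ-negv : ∀ {x} → InΦ Φ x → InΦ Φ (negv x)
  InΦ-negv {x} x∈Φ = subst (InΦ Φ) (s-self x (InΦ⇒≢0 x∈Φ)) (InΦ-s x∈Φ x∈Φ)

  InΦ-δ : ∀ i → InΦ Φ (δ Δ i)
  InΦ-δ i = simple Δ i , refl

  Pos⇒Neg-negv : ∀ {x} → Pos Δ x → Neg Δ (negv x)
  Pos⇒Neg-negv {x} (x∈Φ , c , e) = subst (InΦ Φ) (sym (negv-involutive x)) x∈Φ , c , trans (negv-involutive x) e

  Pos-Neg-disjoint : ∀ {x} → x ≢ 0v → Pos Δ x → Neg Δ x → ⊥
  Pos-Neg-disjoint {x} x≢0 (_ , c , x≡c) (_ , d , -x≡d) = x≢0 (trans x≡c (trans (comb-cong c≡0) comb-zero))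
    where
    c+d≡0 : combℚ Δ (λ i → ℕtoℚ (c i) + ℕtoℚ (d i)) ≡ 0v
    c+d≡0 = trans (comb-distrib-+ (λ i → ℕtoℚ (c i)) (λ i → ℕtoℚ (d i))) (trans (cong₂ _+v_ (sym x≡c) (sym -x≡d)) (-v-self x))
    c≡0 : ∀ i → ℕtoℚ (c i) ≡ 0ℚ
    c≡0 i = nonneg+nonneg≡0⇒≡0 _ _ (ℕtoℚ-nonneg (c i)) (ℕtoℚ-nonneg (d i)) (comb≡0⇒≡0 (λ i → ℕtoℚ (c i) + ℕtoℚ (d i)) c+d≡0 i)

  Pos⊎Neg : ∀ {x} → InΦ Φ x → Pos Δ x ⊎ Neg Δ x
  Pos⊎Neg (j , refl) with sign Δ j
  ... | c , inj₁ e = inj₁ ((j , refl) , c , e)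
  ... | c , inj₂ e = inj₂ (InΦ-negv (j , refl) , c , trans (cong negv e) (negv-involutive (combℕ Δ c)))

  Pos? : ∀ {x} → InΦ Φ x → Dec (Pos Δ x)
  Pos? x∈Φ with Pos⊎Neg x∈Φ
  ... | inj₁ p = yes p
  ... | inj₂ q = no λ p → Pos-Neg-disjoint (InΦ⇒≢0 x∈Φ) p q

  Neg? : ∀ {x} → InΦ Φ x → Dec (Neg Δ x)
  Neg? x∈Φ with Pos⊎Neg x∈Φ
  ... | inj₁ p = no λ q → Pos-Neg-disjoint (InΦ⇒≢0 x∈Φ) p q
  ... | inj₂ q = yes q

  Pos-δ : ∀ i → Pos Δ (δ Δ i)
  Pos-δ i = InΦ-δ i , kronℕ i ,
    trans (sym (·v-identityˡ (δ Δ i))) (trans (sym (comb-kron i 1ℚ)) (comb-cong (λ j → sym (ℕtoℚ-kronℕ i j))))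

  s-δ-comb : ∀ i x c → x ≡ combℕ Δ c →
    s (δ Δ i) x ≡ combℚ Δ (λ j → ℕtoℚ (c j) - kron i j ⟨ x , δ Δ i ∨⟩)
  s-δ-comb i x c x≡c = begin
    s (δ Δ i) x                                                             ≡⟨ s-def (δ Δ i) x ⟩
    x -v (⟨ x , δ Δ i ∨⟩ ·v δ Δ i)                                          ≡⟨ cong₂ _-v_ x≡c (sym (comb-kron i _)) ⟩
    combℕ Δ c -v combℚ Δ (λ j → kron i j ⟨ x , δ Δ i ∨⟩)                    ≡⟨ comb-distrib-- (λ j → ℕtoℚ (c j)) (λ j → kron i j ⟨ x , δ Δ i ∨⟩) ⟨
    combℚ Δ (λ j → ℕtoℚ (c j) - kron i j ⟨ x , δ Δ i ∨⟩)                    ∎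
    where open ≡-Reasoning

  -- s_δ x differs from x only in the δ-coordinate, so if it were negative every other
  -- coordinate of x would vanish and x would be a positive multiple of δ, hence δ by (R2).
  s-δ-Pos : ∀ i {x} → Pos Δ x → x ≢ δ Δ i → Pos Δ (s (δ Δ i) x)
  s-δ-Pos i {x} (x∈Φ , c , x≡c) x≢δ with Pos⊎Neg (InΦ-s (InΦ-δ i) x∈Φ)
  ... | inj₁ p = p
  ... | inj₂ (_ , d , -sx≡d) = contradiction x≡δ x≢δ
    where
    k : ℚ
    k = ⟨ x , δ Δ i ∨⟩
    C D : Fin (r Δ) → ℚ
    C j = ℕtoℚ (c j)
    D j = ℕtoℚ (d j)
    sum≡0 : combℚ Δ (λ j → (C j - kron i j k) + D j) ≡ 0v
    sum≡0 = trans (comb-distrib-+ (λ j → C j - kron i j k) D)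
      (trans (cong₂ _+v_ (sym (s-δ-comb i x c x≡c)) (sym -sx≡d)) (-v-self (s (δ Δ i) x)))
    off-δ : ∀ j → i ≢ j → C j ≡ 0ℚ
    off-δ j i≢j = nonneg+nonneg≡0⇒≡0 (C j) (D j) (ℕtoℚ-nonneg (c j)) (ℕtoℚ-nonneg (d j))
      (trans (cong (_+ D j) C-k≡C) (comb≡0⇒≡0 (λ j → (C j - kron i j k) + D j) sum≡0 j))
      where
      C-k≡C : C j ≡ C j - kron i j k
      C-k≡C = sym (trans (cong (λ z → C j - z) (kron-offdiag i j k i≢j)) (ℚP.+-identityʳ (C j)))
    C≡kron : ∀ j → C j ≡ kron i j (C i)
    C≡kron j with i Fin.≟ j
    ... | yes refl = sym (kron-diag i (C i))
    ... | no i≢j = trans (off-δ j i≢j) (sym (kron-offdiag i j (C i) i≢j))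
    x≡Cδ : x ≡ C i ·v δ Δ i
    x≡Cδ = trans x≡c (trans (comb-cong C≡kron) (comb-kron i (C i)))
    x≡δ : x ≡ δ Δ i
    x≡δ with R2 Φ (simple Δ i) (C i) (subst (InΦ Φ) x≡Cδ x∈Φ)
    ... | inj₁ C≡1 = trans x≡Cδ (trans (cong (_·v δ Δ i) C≡1) (·v-identityˡ (δ Δ i)))
    ... | inj₂ C≡-1 = contradiction C≡-1 (nonneg≢-1 (C i) (ℕtoℚ-nonneg (c i)))

  s-δ-Neg⇒≡δ : ∀ i {x} → Pos Δ x → Neg Δ (s (δ Δ i) x) → x ≡ δ Δ i
  s-δ-Neg⇒≡δ i {x} x⁺ sx⁻ with VecP.≡-dec ℚP._≟_ x (δ Δ i)
  ... | yes x≡δ = x≡δ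
  ... | no x≢δ = ⊥-elim (Pos-Neg-disjoint (InΦ⇒≢0 (InΦ-s (InΦ-δ i) (proj₁ x⁺))) (s-δ-Pos i x⁺ x≢δ) sx⁻)

  ∨-δ-pos : ∀ i x → 0ℚ < ⟪_,_⟫ Φ x (δ Δ i) → 0ℚ < ⟨ x , δ Δ i ∨⟩
  ∨-δ-pos i x 0<⟨x,δ⟩ = *-pos _ _ (*-pos two _ (ℚP.positive⁻¹ two) 0<⟨x,δ⟩)
    (recip-pos _ (⟪⟫-posdef Φ (δ Δ i) (InΦ⇒≢0 (InΦ-δ i))))

  height : (Fin (r Δ) → ℕ) → ℕ
  height = Σℕ (r Δ)

  height-s-δ-< : ∀ i x c → InΦ Φ x → x ≡ combℕ Δ c → x ≢ δ Δ i → 0ℚ < ⟨ x , δ Δ i ∨⟩ →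
    Σ (Fin (r Δ) → ℕ) λ d → s (δ Δ i) x ≡ combℕ Δ d × height d ℕ.< height c
  height-s-δ-< i x c x∈Φ x≡c x≢δ 0<k = d , sx≡d , ℕtoℚ-cancel-< (subst₂ _<_ (sym Σd≡Σc-k) (sym (ℕtoℚ-Σℕ (r Δ) c))
    (p-q<p _ k 0<k))
    where
    k : ℚ
    k = ⟨ x , δ Δ i ∨⟩
    sx⁺ : Pos Δ (s (δ Δ i) x)
    sx⁺ = s-δ-Pos i (x∈Φ , c , x≡c) x≢δ
    d : Fin (r Δ) → ℕ
    d = proj₁ (proj₂ sx⁺)
    sx≡d : s (δ Δ i) x ≡ combℕ Δ d
    sx≡d = proj₂ (proj₂ sx⁺)
    d≡c-k : ∀ j → ℕtoℚ (d j) ≡ ℕtoℚ (c j) - kron i j k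
    d≡c-k = comb-injective _ _ (trans (sym sx≡d) (s-δ-comb i x c x≡c))
    Σd≡Σc-k : ℕtoℚ (height d) ≡ Σℚ (r Δ) (λ j → ℕtoℚ (c j)) - k
    Σd≡Σc-k = trans (ℕtoℚ-Σℕ (r Δ) d) (trans (Σℚ-cong (r Δ) d≡c-k)
      (trans (Σℚ-distrib-- (r Δ) _ _) (cong (λ z → Σℚ (r Δ) (λ j → ℕtoℚ (c j)) - z) (Σℚ-kron (r Δ) i k))))

  -- otherwise (x, x) = Σ cᵢ (δᵢ, x) ≤ 0
  ∃-acute-simple : ∀ {x} → Pos Δ x → Σ (Fin (r Δ)) λ i → 0ℚ < ⟪_,_⟫ Φ x (δ Δ i)
  ∃-acute-simple {x} (x∈Φ , c , x≡c) with FinP.any? (λ i → 0ℚ ℚ.<? ⟪_,_⟫ Φ x (δ Δ i))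
  ... | yes acute = acute
  ... | no none = ⊥-elim (ℚP.<-irrefl refl (ℚP.<-≤-trans (⟪⟫-posdef Φ x (InΦ⇒≢0 x∈Φ)) ⟨x,x⟩≤0))
    where
    ⟨x,x⟩≤0 : ⟪_,_⟫ Φ x x ≤ 0ℚ
    ⟨x,x⟩≤0 = subst (_≤ 0ℚ) (sym (trans (cong (λ z → ⟪_,_⟫ Φ z x) x≡c) (⟨comb,⟩ (λ i → ℕtoℚ (c i)) x)))
      (Σℚ-nonpos (r Δ) (λ i → ℕtoℚ (c i) * ⟪_,_⟫ Φ (δ Δ i) x) λ i → subst (ℕtoℚ (c i) * ⟪_,_⟫ Φ (δ Δ i) x ≤_) (ℚP.*-zeroʳ (ℕtoℚ (c i)))
        (ℚP.*-monoˡ-≤-nonNeg (ℕtoℚ (c i)) {{ℚ.nonNegative (ℕtoℚ-nonneg (c i))}}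
          (subst (_≤ 0ℚ) (⟪⟫-sym Φ x (δ Δ i)) (ℚP.≮⇒≥ λ 0<⟨x,δ⟩ → none (i , 0<⟨x,δ⟩)))))

HasSize : ∀ {k} → (Fin k → Set) → ℕ → Set
HasSize {k} P c = Σ (List (Fin k)) λ xs → Unique xs × (∀ j → (j ∈ xs) ⇔ P j) × length xs ≡ c

opaque
  size : ∀ {k} {P : Fin k → Set} → Decidable P → ℕ
  size {k} P? = length (filter P? (allFin k))

  size-HasSize : ∀ {k} {P : Fin k → Set} (P? : Decidable P) → HasSize P (size P?)
  size-HasSize {k} P? = filter P? (allFin k) , UniqueP.filter⁺ P? (UniqueP.allFin⁺ k) ,
    (λ j → mk⇔ (λ j∈ → proj₂ (∈-filter⁻ P? {xs = allFin k} j∈)) (∈-filter⁺ P? (∈-allFin j))) , refl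

HasSize-unique : ∀ {k} {P : Fin k → Set} {a b} → HasSize P a → HasSize P b → a ≡ b
HasSize-unique (xs , xs! , xs⇔P , refl) (ys , ys! , ys⇔P , refl) =
  ↭-length (∼bag⇒↭ (unique∧set⇒bag xs! ys! λ {j} → mk⇔ (from (ys⇔P j) ∘′ to (xs⇔P j)) (from (xs⇔P j) ∘′ to (ys⇔P j))))

HasSize-⇔ : ∀ {k} {P Q : Fin k → Set} {a} → (∀ j → P j ⇔ Q j) → HasSize P a → HasSize Q a
HasSize-⇔ P⇔Q (xs , xs! , xs⇔P , len) =
  xs , xs! , (λ j → mk⇔ (to (P⇔Q j) ∘′ to (xs⇔P j)) (from (xs⇔P j) ∘′ from (P⇔Q j))) , len

HasSize-∅ : ∀ {k} {P : Fin k → Set} → (∀ j → ¬ P j) → HasSize P 0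
HasSize-∅ ¬P = [] , [] , (λ j → mk⇔ (λ ()) (⊥-elim ∘′ ¬P j)) , refl

HasSize-insert : ∀ {k} {P : Fin k → Set} {a} j₀ → HasSize (λ j → P j × j ≢ j₀) a → P j₀ → HasSize P (suc a)
HasSize-insert {P = P} j₀ (xs , xs! , xs⇔P , len) Pj₀ = j₀ ∷ xs , j₀∉xs ∷ xs! , (λ j → mk⇔ (fwd j) (bwd j)) , cong suc len
  where
  j₀∉xs : All.All (j₀ ≢_) xs
  j₀∉xs = All.tabulate λ {y} y∈xs j₀≡y → proj₂ (to (xs⇔P y) y∈xs) (sym j₀≡y)
  fwd : ∀ j → j ∈ j₀ ∷ xs → P j
  fwd j (here refl) = Pj₀
  fwd j (there j∈xs) = proj₁ (to (xs⇔P j) j∈xs)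
  bwd : ∀ j → P j → j ∈ j₀ ∷ xs
  bwd j Pj with j Fin.≟ j₀
  ... | yes refl = here refl
  ... | no j≢j₀ = there (from (xs⇔P j) (Pj , j≢j₀))

HasSize-skip : ∀ {k} {P : Fin k → Set} {a} j₀ → HasSize (λ j → P j × j ≢ j₀) a → ¬ P j₀ → HasSize P a
HasSize-skip {P = P} j₀ (xs , xs! , xs⇔P , len) ¬Pj₀ = xs , xs! , (λ j → mk⇔ (proj₁ ∘′ to (xs⇔P j)) (bwd j)) , len
  where
  bwd : ∀ j → P j → j ∈ xs
  bwd j Pj with j Fin.≟ j₀
  ... | yes refl = contradiction Pj ¬Pj₀
  ... | no j≢j₀ = from (xs⇔P j) (Pj , j≢j₀)

HasSize-involution : ∀ {k} {P Q : Fin k → Set} {a} (σ : Fin k → Fin k) → (∀ j → σ (σ j) ≡ j) →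
  (∀ j → P (σ j) ⇔ Q j) → HasSize P a → HasSize Q a
HasSize-involution {P = P} {Q} σ σσ≡id Pσ⇔Q (xs , xs! , xs⇔P , len) =
  map σ xs , UniqueP.map⁺ σ-injective xs! , (λ j → mk⇔ (fwd j) (bwd j)) , trans (ListP.length-map σ xs) len
  where
  σ-injective : ∀ {x y} → σ x ≡ σ y → x ≡ y
  σ-injective {x} {y} σx≡σy = trans (sym (σσ≡id x)) (trans (cong σ σx≡σy) (σσ≡id y))
  fwd : ∀ j → j ∈ map σ xs → Q j
  fwd j j∈σxs with ∈-map⁻ σ j∈σxs
  ... | x , x∈xs , refl = to (Pσ⇔Q (σ x)) (subst P (sym (σσ≡id x)) (to (xs⇔P x) x∈xs))
  bwd : ∀ j → Q j → j ∈ map σ xs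
  bwd j Qj = subst (_∈ map σ xs) (σσ≡id j) (∈-map⁺ σ (from (xs⇔P (σ j)) (from (Pσ⇔Q j) Qj)))

module Inversions {n : ℕ} {Φ : RootSystem n} (Δ : Base Φ) where
  open Reflections Φ
  open Roots Δ

  act-++ : ∀ u v x → act Δ (u ++ v) x ≡ act Δ u (act Δ v x)
  act-++ [] v x = refl
  act-++ (i ∷ u) v x = cong (s (root Φ i)) (act-++ u v x)

  act-negv : ∀ w x → act Δ w (negv x) ≡ negv (act Δ w x)
  act-negv [] x = refl
  act-negv (i ∷ w) x = trans (cong (s (root Φ i)) (act-negv w x)) (s-negv (root Φ i) (act Δ w x))

  act-s : ∀ w a x → act Δ w (s a x) ≡ s (act Δ w a) (act Δ w x)
  act-s [] a x = refl
  act-s (i ∷ w) a x = trans (cong (s (root Φ i)) (act-s w a x)) (s-conj (root Φ i) (act Δ w a) (act Δ w x))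

  act-InΦ : ∀ w {x} → InΦ Φ x → InΦ Φ (act Δ w x)
  act-InΦ [] x∈Φ = x∈Φ
  act-InΦ (i ∷ w) x∈Φ = InΦ-s (i , refl) (act-InΦ w x∈Φ)

  act-inv-∷ : ∀ i w x → act Δ (inv Δ (i ∷ w)) x ≡ act Δ (inv Δ w) (s (root Φ i) x)
  act-inv-∷ i w x = trans (cong (λ u → act Δ u x) (ListP.unfold-reverse i w)) (act-++ (reverse w) (i ∷ []) x)

  act-inv-act : ∀ w x → act Δ (inv Δ w) (act Δ w x) ≡ x
  act-inv-act [] x = refl
  act-inv-act (i ∷ w) x = begin
    act Δ (inv Δ (i ∷ w)) (act Δ (i ∷ w) x)        ≡⟨ act-inv-∷ i w _ ⟩
    act Δ (inv Δ w) (s (root Φ i) (s (root Φ i) (act Δ w x)))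
                                                    ≡⟨ cong (act Δ (inv Δ w)) (s-involutive (root Φ i) (act Δ w x)) ⟩
    act Δ (inv Δ w) (act Δ w x)                     ≡⟨ act-inv-act w x ⟩
    x                                               ∎
    where open ≡-Reasoning

  act-act-inv : ∀ w x → act Δ w (act Δ (inv Δ w) x) ≡ x
  act-act-inv w x = subst (λ u → act Δ u (act Δ (inv Δ w) x) ≡ x) (ListP.reverse-involutive w) (act-inv-act (inv Δ w) x)

  ≈W-inv : ∀ u v → _≈W_ Δ u v → ∀ x → act Δ (inv Δ u) x ≡ act Δ (inv Δ v) x
  ≈W-inv u v u≈v x = begin
    act Δ (inv Δ u) x                                   ≡⟨ cong (act Δ (inv Δ u)) (act-act-inv v x) ⟨
    act Δ (inv Δ u) (act Δ v (act Δ (inv Δ v) x))       ≡⟨ cong (act Δ (inv Δ u)) (u≈v _) ⟨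
    act Δ (inv Δ u) (act Δ u (act Δ (inv Δ v) x))       ≡⟨ act-inv-act u _ ⟩
    act Δ (inv Δ v) x                                   ∎
    where open ≡-Reasoning

  inv-≈W : ∀ u v → (∀ y → act Δ u (act Δ v y) ≡ y) → _≈W_ Δ (inv Δ u) v
  inv-≈W u v uv≡id y = trans (cong (act Δ (inv Δ u)) (sym (uv≡id y))) (act-inv-act u (act Δ v y))

  N? : ∀ w → Decidable (N Δ w)
  N? w j = Pos? (j , refl) ×-dec Neg? (act-InΦ (inv Δ w) (j , refl))

  invCount : W Δ → ℕ
  invCount w = size (N? w)

  invCount-HasCard : ∀ w → HasCard Δ (N Δ w) (invCount w)
  invCount-HasCard w = size-HasSize (N? w)

  invCount-≈W : ∀ u v → _≈W_ Δ u v → invCount u ≡ invCount v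
  invCount-≈W u v u≈v = HasSize-unique (HasSize-⇔ Nu⇔Nv (invCount-HasCard u)) (invCount-HasCard v)
    where
    Nu⇔Nv : ∀ j → N Δ u j ⇔ N Δ v j
    Nu⇔Nv j = mk⇔ (λ (j⁺ , u⁻¹j⁻) → j⁺ , subst (Neg Δ) (≈W-inv u v u≈v (root Φ j)) u⁻¹j⁻)
                  (λ (j⁺ , v⁻¹j⁻) → j⁺ , subst (Neg Δ) (sym (≈W-inv u v u≈v (root Φ j))) v⁻¹j⁻)

  invCount-[] : invCount [] ≡ 0
  invCount-[] = HasSize-unique (invCount-HasCard [])
    (HasSize-∅ λ j (j⁺ , j⁻) → Pos-Neg-disjoint (root-nz Φ j) j⁺ j⁻)

  -- s_δ permutes Φ⁺ ∖ {δ}, so N_{s_δ u} and N_u agree away from δ up to this permutation,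
  -- and δ lies in exactly one of them.
  module _ (i : Fin (r Δ)) (u : W Δ) where
    private
      δᵢ u⁻¹δ : V n
      δᵢ = δ Δ i
      u⁻¹δ = act Δ (inv Δ u) δᵢ
      ĩ : Fin (m Φ)
      ĩ = simple Δ i

      σ : Fin (m Φ) → Fin (m Φ)
      σ j = proj₁ (InΦ-s (InΦ-δ i) (j , refl))

      root-σ : ∀ j → root Φ (σ j) ≡ s δᵢ (root Φ j)
      root-σ j = proj₂ (InΦ-s (InΦ-δ i) (j , refl))

      σ-involutive : ∀ j → σ (σ j) ≡ j
      σ-involutive j = root-inj Φ _ _
        (trans (root-σ (σ j)) (trans (cong (s δᵢ) (root-σ j)) (s-involutive δᵢ (root Φ j))))

      Pos∖δ : Fin (m Φ) → Set
      Pos∖δ j = Pos Δ (root Φ j) × j ≢ ĩ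

      σ-Pos∖δ : ∀ a b → root Φ b ≡ s δᵢ (root Φ a) → Pos∖δ a → Pos∖δ b
      σ-Pos∖δ a b b≡sa (a⁺ , a≢ĩ) = subst (Pos Δ) (sym b≡sa) (s-δ-Pos i a⁺ (a≢ĩ ∘′ root-inj Φ _ _)) , b≢ĩ
        where
        b≢ĩ : b ≢ ĩ
        b≢ĩ refl = Pos-Neg-disjoint (root-nz Φ a) a⁺ (subst (Neg Δ) a≡-δ (Pos⇒Neg-negv (Pos-δ i)))
          where
          a≡-δ : negv δᵢ ≡ root Φ a
          a≡-δ = begin
            negv δᵢ                   ≡⟨ s-self δᵢ (root-nz Φ ĩ) ⟨
            s δᵢ δᵢ                   ≡⟨ cong (s δᵢ) b≡sa ⟩
            s δᵢ (s δᵢ (root Φ a))    ≡⟨ s-involutive δᵢ (root Φ a) ⟩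
            root Φ a                  ∎
            where open ≡-Reasoning

      Nu∖δ Nsu∖δ : Fin (m Φ) → Set
      Nu∖δ j = N Δ u j × j ≢ ĩ
      Nsu∖δ j = N Δ (ĩ ∷ u) j × j ≢ ĩ

      Nu∖δ? : Decidable Nu∖δ
      Nu∖δ? j = N? u j ×-dec ¬? (j Fin.≟ ĩ)

      Nu∖δ-size : HasSize Nu∖δ (size Nu∖δ?)
      Nu∖δ-size = size-HasSize Nu∖δ?

      act-inv-s∷ : ∀ y → act Δ (inv Δ (ĩ ∷ u)) y ≡ act Δ (inv Δ u) (s δᵢ y)
      act-inv-s∷ = act-inv-∷ ĩ u

      Nu∖δ∘σ⇔Nsu∖δ : ∀ j → Nu∖δ (σ j) ⇔ Nsu∖δ j
      Nu∖δ∘σ⇔Nsu∖δ j = mk⇔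
        (λ ((σj⁺ , u⁻¹σj⁻) , σj≢ĩ) →
          let (j⁺ , j≢ĩ) = σ-Pos∖δ (σ j) j σσj≡ (σj⁺ , σj≢ĩ)
          in (j⁺ , subst (Neg Δ) (sym act≡) u⁻¹σj⁻) , j≢ĩ)
        (λ ((j⁺ , su⁻¹j⁻) , j≢ĩ) →
          let (σj⁺ , σj≢ĩ) = σ-Pos∖δ j (σ j) (root-σ j) (j⁺ , j≢ĩ)
          in (σj⁺ , subst (Neg Δ) act≡ su⁻¹j⁻) , σj≢ĩ)
        where
        σσj≡ : root Φ j ≡ s δᵢ (root Φ (σ j))
        σσj≡ = trans (sym (s-involutive δᵢ (root Φ j))) (cong (s δᵢ) (sym (root-σ j)))
        act≡ : act Δ (inv Δ (ĩ ∷ u)) (root Φ j) ≡ act Δ (inv Δ u) (root Φ (σ j))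
        act≡ = trans (act-inv-s∷ (root Φ j)) (cong (act Δ (inv Δ u)) (sym (root-σ j)))

      Nsu∖δ-size : HasSize Nsu∖δ (size Nu∖δ?)
      Nsu∖δ-size = HasSize-involution σ σ-involutive Nu∖δ∘σ⇔Nsu∖δ Nu∖δ-size

      s∷u⁻¹δ≡ : act Δ (inv Δ (ĩ ∷ u)) δᵢ ≡ negv u⁻¹δ
      s∷u⁻¹δ≡ = trans (act-inv-s∷ δᵢ) (trans (cong (act Δ (inv Δ u)) (s-self δᵢ (root-nz Φ ĩ))) (act-negv (inv Δ u) δᵢ))

      u⁻¹δ∈Φ : InΦ Φ u⁻¹δ
      u⁻¹δ∈Φ = act-InΦ (inv Δ u) (InΦ-δ i)

    invCount-∷-δ⁺ : Pos Δ u⁻¹δ → invCount (ĩ ∷ u) ≡ suc (invCount u)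
    invCount-∷-δ⁺ u⁻¹δ⁺ = begin
      invCount (ĩ ∷ u)     ≡⟨ HasSize-unique (invCount-HasCard (ĩ ∷ u)) (HasSize-insert ĩ Nsu∖δ-size ĩ∈Nsu) ⟩
      suc (size Nu∖δ?)     ≡⟨ cong suc (HasSize-unique (HasSize-skip ĩ Nu∖δ-size ĩ∉Nu) (invCount-HasCard u)) ⟩
      suc (invCount u)     ∎
      where
      open ≡-Reasoning
      ĩ∈Nsu : N Δ (ĩ ∷ u) ĩ
      ĩ∈Nsu = Pos-δ i , subst (Neg Δ) (sym s∷u⁻¹δ≡) (Pos⇒Neg-negv u⁻¹δ⁺)
      ĩ∉Nu : ¬ N Δ u ĩ
      ĩ∉Nu (_ , u⁻¹δ⁻) = Pos-Neg-disjoint (InΦ⇒≢0 u⁻¹δ∈Φ) u⁻¹δ⁺ u⁻¹δ⁻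

    invCount-∷-δ⁻ : Neg Δ u⁻¹δ → invCount u ≡ suc (invCount (ĩ ∷ u))
    invCount-∷-δ⁻ u⁻¹δ⁻ = begin
      invCount u                 ≡⟨ HasSize-unique (invCount-HasCard u) (HasSize-insert ĩ Nu∖δ-size (Pos-δ i , u⁻¹δ⁻)) ⟩
      suc (size Nu∖δ?)           ≡⟨ cong suc (HasSize-unique (HasSize-skip ĩ Nsu∖δ-size ĩ∉Nsu) (invCount-HasCard (ĩ ∷ u))) ⟩
      suc (invCount (ĩ ∷ u))     ∎
      where
      open ≡-Reasoning
      ĩ∉Nsu : ¬ N Δ (ĩ ∷ u) ĩ
      ĩ∉Nsu (_ , su⁻¹δ⁻) = Pos-Neg-disjoint (InΦ⇒≢0 u⁻¹δ∈Φ)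
        (subst (Pos Δ) (negv-involutive u⁻¹δ) (subst (Neg Δ) s∷u⁻¹δ≡ su⁻¹δ⁻)) u⁻¹δ⁻

  simpleWord : List (Fin (r Δ)) → W Δ
  simpleWord = map (simple Δ)

  act-simpleWord-++ : ∀ p q x → act Δ (simpleWord (p ++ q)) x ≡ act Δ (simpleWord p) (act Δ (simpleWord q) x)
  act-simpleWord-++ p q x = trans (cong (λ u → act Δ u x) (ListP.map-++ (simple Δ) p q)) (act-++ (simpleWord p) (simpleWord q) x)

  invCount-simpleWord-≤ : ∀ ws → invCount (simpleWord ws) ℕ.≤ length ws
  invCount-simpleWord-≤ [] = ℕP.≤-reflexive invCount-[]
  invCount-simpleWord-≤ (i ∷ ws) = case Pos⊎Neg (act-InΦ (inv Δ (simpleWord ws)) (InΦ-δ i)) of λ where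
    (inj₁ u⁻¹δ⁺) → ℕP.≤-trans (ℕP.≤-reflexive (invCount-∷-δ⁺ i (simpleWord ws) u⁻¹δ⁺)) (s≤s (invCount-simpleWord-≤ ws))
    (inj₂ u⁻¹δ⁻) → ℕP.m<n⇒m≤1+n (ℕP.<-≤-trans (ℕP.≤-reflexive (sym (invCount-∷-δ⁻ i (simpleWord ws) u⁻¹δ⁻)))
                                              (invCount-simpleWord-≤ ws))

  invCount-≤-length : ∀ w ws → _≈W_ Δ (simpleWord ws) w → invCount w ℕ.≤ length ws
  invCount-≤-length w ws ws≈w = subst (ℕ._≤ length ws) (invCount-≈W (simpleWord ws) w ws≈w) (invCount-simpleWord-≤ ws)

  -- the letter j of q at which α, pulled back along q, first turns negative
  sign-change : ∀ q α → Pos Δ α → Neg Δ (act Δ (inv Δ (simpleWord q)) α) →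
    Σ[ p ∈ List (Fin (r Δ)) ] Σ[ j ∈ Fin (r Δ) ] Σ[ rest ∈ List (Fin (r Δ)) ]
      q ≡ p ++ j ∷ rest × act Δ (inv Δ (simpleWord p)) α ≡ δ Δ j
  sign-change [] α α⁺ α⁻ = ⊥-elim (Pos-Neg-disjoint (InΦ⇒≢0 (proj₁ α⁺)) α⁺ α⁻)
  sign-change (j ∷ q) α α⁺ q⁻¹α⁻ with Pos⊎Neg (InΦ-s (InΦ-δ j) (proj₁ α⁺))
  ... | inj₂ sα⁻ = [] , j , q , refl , s-δ-Neg⇒≡δ j α⁺ sα⁻
  ... | inj₁ sα⁺ with sign-change q (s (δ Δ j) α) sα⁺ (subst (Neg Δ) (act-inv-∷ (simple Δ j) (simpleWord q) α) q⁻¹α⁻)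
  ...   | p , j′ , rest , q≡ , p⁻¹sα≡δ =
    j ∷ p , j′ , rest , cong (j ∷_) q≡ , trans (act-inv-∷ (simple Δ j) (simpleWord p) α) p⁻¹sα≡δ

  -- deletion property: s_α q drops the letter found by sign-change
  deletion : ∀ q α → Pos Δ α → Neg Δ (act Δ (inv Δ (simpleWord q)) α) →
    Σ[ q′ ∈ List (Fin (r Δ)) ] length q′ ℕ.< length q ×
      (∀ x → act Δ (simpleWord q′) x ≡ s α (act Δ (simpleWord q) x))
  deletion q α α⁺ q⁻¹α⁻ with sign-change q α α⁺ q⁻¹α⁻
  ... | p , j , rest , refl , p⁻¹α≡δ = p ++ rest , shorter , act≡
    where
    P : V n → V n
    P = act Δ (simpleWord p)
    Pδ≡α : P (δ Δ j) ≡ α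
    Pδ≡α = trans (cong P (sym p⁻¹α≡δ)) (act-act-inv (simpleWord p) α)
    shorter : length (p ++ rest) ℕ.< length (p ++ j ∷ rest)
    shorter = subst₂ ℕ._<_ (sym (ListP.length-++ p)) (sym (ListP.length-++ p))
      (ℕP.+-monoʳ-< (length p) (ℕP.n<1+n (length rest)))
    act≡ : ∀ x → act Δ (simpleWord (p ++ rest)) x ≡ s α (act Δ (simpleWord (p ++ j ∷ rest)) x)
    act≡ x = begin
      act Δ (simpleWord (p ++ rest)) x                 ≡⟨ act-simpleWord-++ p rest x ⟩
      P y                                              ≡⟨ s-involutive α (P y) ⟨
      s α (s α (P y))                                  ≡⟨ cong (λ z → s α (s z (P y))) Pδ≡α ⟨
      s α (s (P (δ Δ j)) (P y))                        ≡⟨ cong (s α) (act-s (simpleWord p) (δ Δ j) y) ⟨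
      s α (P (s (δ Δ j) y))                            ≡⟨ cong (s α) (act-simpleWord-++ p (j ∷ rest) x) ⟨
      s α (act Δ (simpleWord (p ++ j ∷ rest)) x)       ∎
      where
      open ≡-Reasoning
      y : V n
      y = act Δ (simpleWord rest) x

  shorten : ∀ ws → invCount (simpleWord ws) ℕ.< length ws →
    Σ[ ws′ ∈ List (Fin (r Δ)) ] length ws′ ℕ.< length ws × _≈W_ Δ (simpleWord ws′) (simpleWord ws)
  shorten [] ()
  shorten (i ∷ ws) lt = go (invCount (simpleWord ws) ℕ.<? length ws)
    where
    Shorter : Set
    Shorter = Σ[ ws′ ∈ List (Fin (r Δ)) ] length ws′ ℕ.< length (i ∷ ws) × _≈W_ Δ (simpleWord ws′) (simpleWord (i ∷ ws))
    go : Dec (invCount (simpleWord ws) ℕ.< length ws) → Shorter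
    go (yes lt′) = let (ws′ , shorter , ws′≈ws) = shorten ws lt′
                   in i ∷ ws′ , s≤s shorter , λ x → cong (s (δ Δ i)) (ws′≈ws x)
    go (no ¬lt′) = case Pos⊎Neg (act-InΦ (inv Δ (simpleWord ws)) (InΦ-δ i)) of λ where
      (inj₁ u⁻¹δ⁺) → contradiction (ℕP.≤-pred (subst (ℕ._< suc (length ws)) (invCount-∷-δ⁺ i (simpleWord ws) u⁻¹δ⁺) lt)) ¬lt′
      (inj₂ u⁻¹δ⁻) → let (ws′ , shorter , act≡) = deletion ws (δ Δ i) (Pos-δ i) u⁻¹δ⁻
                     in ws′ , ℕP.m<n⇒m<1+n shorter , act≡

  reduced-word-acc : ∀ ws → Acc ℕ._<_ (length ws) →
    Σ[ ws′ ∈ List (Fin (r Δ)) ] _≈W_ Δ (simpleWord ws′) (simpleWord ws) × length ws′ ≡ invCount (simpleWord ws)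
  reduced-word-acc ws (acc rec) = go (invCount (simpleWord ws) ℕ.<? length ws)
    where
    Reduced : Set
    Reduced = Σ[ ws′ ∈ List (Fin (r Δ)) ] _≈W_ Δ (simpleWord ws′) (simpleWord ws) × length ws′ ≡ invCount (simpleWord ws)
    go : Dec (invCount (simpleWord ws) ℕ.< length ws) → Reduced
    go (no ¬lt) = ws , (λ x → refl) , ℕP.≤-antisym (ℕP.≮⇒≥ ¬lt) (invCount-simpleWord-≤ ws)
    go (yes lt) = let (ws′ , shorter , ws′≈ws) = shorten ws lt
                      (ws″ , ws″≈ws′ , len) = reduced-word-acc ws′ (rec shorter)
                  in ws″ , (λ x → trans (ws″≈ws′ x) (ws′≈ws x)) ,
                     trans len (invCount-≈W (simpleWord ws′) (simpleWord ws) ws′≈ws)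

  reduced-word : ∀ ws →
    Σ[ ws′ ∈ List (Fin (r Δ)) ] _≈W_ Δ (simpleWord ws′) (simpleWord ws) × length ws′ ≡ invCount (simpleWord ws)
  reduced-word ws = reduced-word-acc ws (<-wellFounded (length ws))

  act-conj-simpleWord : ∀ i x ws → (∀ y → act Δ (simpleWord ws) y ≡ s (s (δ Δ i) x) y) →
    ∀ y → act Δ (simpleWord (i ∷ (ws ++ i ∷ []))) y ≡ s x y
  act-conj-simpleWord i x ws ws≡s y = begin
    s δᵢ (act Δ (simpleWord (ws ++ i ∷ [])) y)    ≡⟨ cong (s δᵢ) (act-simpleWord-++ ws (i ∷ []) y) ⟩
    s δᵢ (act Δ (simpleWord ws) (s δᵢ y))         ≡⟨ cong (s δᵢ) (ws≡s (s δᵢ y)) ⟩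
    s δᵢ (s (s δᵢ x) (s δᵢ y))                    ≡⟨ s-conj δᵢ (s δᵢ x) (s δᵢ y) ⟩
    s (s δᵢ (s δᵢ x)) (s δᵢ (s δᵢ y))             ≡⟨ cong₂ s (s-involutive δᵢ x) (s-involutive δᵢ y) ⟩
    s x y                                         ∎
    where
    open ≡-Reasoning
    δᵢ : V n
    δᵢ = δ Δ i

  -- s_δ x has smaller height than x for an acute simple root δ, and s_x = s_δ s_{s_δ x} s_δ
  reflection-word⁺ : ∀ h x c → InΦ Φ x → x ≡ combℕ Δ c → height c ℕ.< h →
    Σ[ ws ∈ List (Fin (r Δ)) ] ∀ y → act Δ (simpleWord ws) y ≡ s x y
  reflection-word⁺ (suc h) x c x∈Φ x≡c ht<h with FinP.any? (λ i → VecP.≡-dec ℚP._≟_ x (δ Δ i))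
  ... | yes (i , x≡δ) = i ∷ [] , λ y → cong (λ z → s z y) (sym x≡δ)
  ... | no x∉Δ = i ∷ (ws ++ i ∷ []) , act-conj-simpleWord i x ws ws≡s
    where
    acute : Σ (Fin (r Δ)) λ i → 0ℚ < ⟪_,_⟫ Φ x (δ Δ i)
    acute = ∃-acute-simple (x∈Φ , c , x≡c)
    i : Fin (r Δ)
    i = proj₁ acute
    lower : Σ (Fin (r Δ) → ℕ) λ d → s (δ Δ i) x ≡ combℕ Δ d × height d ℕ.< height c
    lower = height-s-δ-< i x c x∈Φ x≡c (λ x≡δ → x∉Δ (i , x≡δ)) (∨-δ-pos i x (proj₂ acute))
    recursive : Σ[ ws ∈ List (Fin (r Δ)) ] ∀ y → act Δ (simpleWord ws) y ≡ s (s (δ Δ i) x) y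
    recursive = reflection-word⁺ h (s (δ Δ i) x) (proj₁ lower) (InΦ-s (InΦ-δ i) x∈Φ) (proj₁ (proj₂ lower))
                  (ℕP.<-≤-trans (proj₂ (proj₂ lower)) (ℕP.≤-pred ht<h))
    ws : List (Fin (r Δ))
    ws = proj₁ recursive
    ws≡s : ∀ y → act Δ (simpleWord ws) y ≡ s (s (δ Δ i) x) y
    ws≡s = proj₂ recursive

  reflection-word : ∀ b → Σ[ ws ∈ List (Fin (r Δ)) ] ∀ y → act Δ (simpleWord ws) y ≡ s (root Φ b) y
  reflection-word b = case Pos⊎Neg (b , refl) of λ where
    (inj₁ (b∈Φ , c , b≡c)) → reflection-word⁺ (suc (height c)) (root Φ b) c b∈Φ b≡c ℕP.≤-refl
    (inj₂ (-b∈Φ , c , -b≡c)) →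
      let (ws , act≡) = reflection-word⁺ (suc (height c)) (negv (root Φ b)) c -b∈Φ -b≡c ℕP.≤-refl
      in ws , λ y → trans (act≡ y) (s-negv-root (root Φ b) y)

  simple-expression : ∀ w → Σ[ ws ∈ List (Fin (r Δ)) ] _≈W_ Δ (simpleWord ws) w
  simple-expression [] = [] , λ x → refl
  simple-expression (b ∷ w) =
    let (bs , bs≡s) = reflection-word b
        (ws , ws≈w) = simple-expression w
    in bs ++ ws , λ x → trans (act-simpleWord-++ bs ws x) (trans (bs≡s _) (cong (s (root Φ b)) (ws≈w x)))

  IsLength-invCount : ∀ w → IsLength Δ w (invCount w)
  IsLength-invCount w =
    let (ws , ws≈w) = simple-expression w
        (ws′ , ws′≈ws , len) = reduced-word ws
    in (ws′ , trans len (invCount-≈W (simpleWord ws) w ws≈w) , (λ x → trans (ws′≈ws x) (ws≈w x))) , invCount-≤-length w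

  IsLength⇒≡invCount : ∀ w k → IsLength Δ w k → k ≡ invCount w
  IsLength⇒≡invCount w k ((ws , len , ws≈w) , minimal) =
    let ((ws′ , len′ , ws′≈w) , _) = IsLength-invCount w
    in ℕP.≤-antisym (subst (k ℕ.≤_) len′ (minimal ws′ ws′≈w)) (subst (invCount w ℕ.≤_) len (invCount-≤-length w ws ws≈w))

  simpleWord-reverse : ∀ ws → simpleWord (reverse ws) ≡ inv Δ (simpleWord ws)
  simpleWord-reverse = ListP.reverse-map (simple Δ)

  act-inv-simpleWord-reverse : ∀ ws x → act Δ (inv Δ (simpleWord (reverse ws))) x ≡ act Δ (simpleWord ws) x
  act-inv-simpleWord-reverse ws x = trans (cong (λ u → act Δ (reverse u) x) (simpleWord-reverse ws))
    (cong (λ u → act Δ u x) (ListP.reverse-involutive (simpleWord ws)))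

  -- w s_β has a shorter expression: delete a letter from a reduced word of w⁻¹ = s_{i_k} ⋯ s_{i_1}
  invCount-·s-< : ∀ w b → Pos Δ (root Φ b) → Neg Δ (act Δ w (root Φ b)) → invCount (w ++ b ∷ []) ℕ.< invCount w
  invCount-·s-< w b β⁺ wβ⁻ = ℕP.≤-<-trans (invCount-≤-length (w ++ b ∷ []) (reverse q′) q′⁻¹≈wsβ)
    (subst₂ ℕ._<_ (sym (ListP.length-reverse q′)) (trans (ListP.length-reverse ws) len) shorter)
    where
    open ≡-Reasoning
    β : V n
    β = root Φ b
    reduced : Σ[ ws ∈ List (Fin (r Δ)) ] length ws ≡ invCount w × _≈W_ Δ (simpleWord ws) w
    reduced = proj₁ (IsLength-invCount w)
    ws : List (Fin (r Δ))
    ws = proj₁ reduced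
    len : length ws ≡ invCount w
    len = proj₁ (proj₂ reduced)
    ws≈w : _≈W_ Δ (simpleWord ws) w
    ws≈w = proj₂ (proj₂ reduced)
    deleted : Σ[ q′ ∈ List (Fin (r Δ)) ] length q′ ℕ.< length (reverse ws) ×
                (∀ x → act Δ (simpleWord q′) x ≡ s β (act Δ (simpleWord (reverse ws)) x))
    deleted = deletion (reverse ws) β β⁺ (subst (Neg Δ) (sym (trans (act-inv-simpleWord-reverse ws β) (ws≈w β))) wβ⁻)
    q′ : List (Fin (r Δ))
    q′ = proj₁ deleted
    shorter : length q′ ℕ.< length (reverse ws)
    shorter = proj₁ (proj₂ deleted)
    q′≡sβws⁻¹ : ∀ x → act Δ (simpleWord q′) x ≡ s β (act Δ (simpleWord (reverse ws)) x)
    q′≡sβws⁻¹ = proj₂ (proj₂ deleted)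
    ws⁻¹≈w⁻¹ : ∀ x → act Δ (simpleWord (reverse ws)) x ≡ act Δ (inv Δ w) x
    ws⁻¹≈w⁻¹ x = trans (cong (λ u → act Δ u x) (simpleWord-reverse ws)) (≈W-inv (simpleWord ws) w ws≈w x)
    q′-cancels : ∀ y → act Δ (simpleWord q′) (act Δ (w ++ b ∷ []) y) ≡ y
    q′-cancels y = begin
      act Δ (simpleWord q′) (act Δ (w ++ b ∷ []) y)                    ≡⟨ q′≡sβws⁻¹ _ ⟩
      s β (act Δ (simpleWord (reverse ws)) (act Δ (w ++ b ∷ []) y))     ≡⟨ cong (s β) (ws⁻¹≈w⁻¹ _) ⟩
      s β (act Δ (inv Δ w) (act Δ (w ++ b ∷ []) y))                     ≡⟨ cong (λ z → s β (act Δ (inv Δ w) z)) (act-++ w (b ∷ []) y) ⟩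
      s β (act Δ (inv Δ w) (act Δ w (s β y)))                           ≡⟨ cong (s β) (act-inv-act w (s β y)) ⟩
      s β (s β y)                                                       ≡⟨ s-involutive β y ⟩
      y                                                                 ∎
    q′⁻¹≈wsβ : _≈W_ Δ (simpleWord (reverse q′)) (w ++ b ∷ [])
    q′⁻¹≈wsβ y = trans (cong (λ u → act Δ u y) (simpleWord-reverse q′)) (inv-≈W (simpleWord q′) (w ++ b ∷ []) q′-cancels y)

  -- u = (s_α u) s_β with β = u⁻¹α
  BruhatStep⇒invCount-< : ∀ u v → BruhatStep Δ u v → invCount u ℕ.< invCount v
  BruhatStep⇒invCount-< u v (i , α⁺ , v≈su , v⁻¹α⁻) =
    subst (ℕ._< invCount v) (sym (invCount-≈W u (v ++ b ∷ []) u≈vsβ)) (invCount-·s-< v b β⁺ vβ⁻)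
    where
    α : V n
    α = root Φ i
    b : Fin (m Φ)
    b = proj₁ (act-InΦ (inv Δ u) (i , refl))
    β≡u⁻¹α : root Φ b ≡ act Δ (inv Δ u) α
    β≡u⁻¹α = proj₂ (act-InΦ (inv Δ u) (i , refl))
    v⁻¹α≡-β : act Δ (inv Δ v) α ≡ negv (root Φ b)
    v⁻¹α≡-β = begin
      act Δ (inv Δ v) α               ≡⟨ ≈W-inv v (i ∷ u) v≈su α ⟩
      act Δ (inv Δ (i ∷ u)) α         ≡⟨ act-inv-∷ i u α ⟩
      act Δ (inv Δ u) (s α α)         ≡⟨ cong (act Δ (inv Δ u)) (s-self α (root-nz Φ i)) ⟩
      act Δ (inv Δ u) (negv α)        ≡⟨ act-negv (inv Δ u) α ⟩
      negv (act Δ (inv Δ u) α)        ≡⟨ cong negv β≡u⁻¹α ⟨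
      negv (root Φ b)                 ∎
      where open ≡-Reasoning
    β⁺ : Pos Δ (root Φ b)
    β⁺ = subst (Pos Δ) (trans (cong negv v⁻¹α≡-β) (negv-involutive _)) v⁻¹α⁻
    vβ≡-α : act Δ v (root Φ b) ≡ negv α
    vβ≡-α = begin
      act Δ v (root Φ b)                   ≡⟨ cong (act Δ v) β≡u⁻¹α ⟩
      act Δ v (act Δ (inv Δ u) α)          ≡⟨ v≈su _ ⟩
      s α (act Δ u (act Δ (inv Δ u) α))    ≡⟨ cong (s α) (act-act-inv u α) ⟩
      s α α                                ≡⟨ s-self α (root-nz Φ i) ⟩
      negv α                               ∎
      where open ≡-Reasoning
    vβ⁻ : Neg Δ (act Δ v (root Φ b))
    vβ⁻ = subst (Neg Δ) (sym vβ≡-α) (Pos⇒Neg-negv α⁺)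
    u≈vsβ : _≈W_ Δ u (v ++ b ∷ [])
    u≈vsβ y = sym (begin
      act Δ (v ++ b ∷ []) y                  ≡⟨ act-++ v (b ∷ []) y ⟩
      act Δ v (s (root Φ b) y)               ≡⟨ act-s v (root Φ b) y ⟩
      s (act Δ v (root Φ b)) (act Δ v y)     ≡⟨ cong (λ z → s z (act Δ v y)) vβ≡-α ⟩
      s (negv α) (act Δ v y)                 ≡⟨ s-negv-root α (act Δ v y) ⟩
      s α (act Δ v y)                        ≡⟨ cong (s α) (v≈su y) ⟩
      s α (s α (act Δ u y))                  ≡⟨ s-involutive α (act Δ u y) ⟩
      act Δ u y                              ∎)
      where open ≡-Reasoning

  <B⇒invCount-< : ∀ {w v} → _<B_ Δ w v → invCount w ℕ.< invCount v
  <B⇒invCount-< {w} {v} [ step ] = BruhatStep⇒invCount-< w v step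
  <B⇒invCount-< {w} (_∷_ {y = w′} step w′<v) = ℕP.<-trans (BruhatStep⇒invCount-< w w′ step) (<B⇒invCount-< w′<v)

  <B-cover : ∀ {w v} → _<B_ Δ w v → invCount v ≡ suc (invCount w) → IsCover Δ v w
  <B-cover {w} {v} [ i , α⁺ , v≈sw , _ ] len =
    i , α⁺ , v≈sw , invCount w , IsLength-invCount w , subst (IsLength Δ v) len (IsLength-invCount v)
  <B-cover {w} (_∷_ {y = w′} step w′<v) len = contradiction (sym len)
    (ℕP.<⇒≢ (ℕP.<-≤-trans (s≤s (BruhatStep⇒invCount-< w w′ step)) (<B⇒invCount-< w′<v)))

  IsCover⇒invCount : ∀ {v w} → IsCover Δ v w → invCount v ≡ suc (invCount w)
  IsCover⇒invCount {v} {w} (_ , _ , _ , k , w-len , v-len) =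
    trans (sym (IsLength⇒≡invCount v (suc k) v-len)) (cong suc (IsLength⇒≡invCount w k w-len))

module HighestRootInversions {n : ℕ} {Φ : RootSystem n} (Δ : Base Φ) (γ : Fin (m Φ)) where
  open Reflections Φ
  open Roots Δ
  open Inversions Δ

  β : W Δ → Fin (m Φ)
  β w = proj₁ (act-InΦ w (InΦ-negv (γ , refl)))

  act-inv-β : ∀ w → act Δ (inv Δ w) (root Φ (β w)) ≡ negv (root Φ γ)
  act-inv-β w = trans (cong (act Δ (inv Δ w)) (proj₂ (act-InΦ w (InΦ-negv (γ , refl)))))
                      (act-inv-act w (negv (root Φ γ)))

  β-unique : ∀ w j → act Δ (inv Δ w) (root Φ j) ≡ negv (root Φ γ) → j ≡ β w
  β-unique w j w⁻¹j≡-γ = root-inj Φ _ _ (begin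
    root Φ j                                      ≡⟨ act-act-inv w (root Φ j) ⟨
    act Δ w (act Δ (inv Δ w) (root Φ j))          ≡⟨ cong (act Δ w) (trans w⁻¹j≡-γ (sym (act-inv-β w))) ⟩
    act Δ w (act Δ (inv Δ w) (root Φ (β w)))      ≡⟨ act-act-inv w (root Φ (β w)) ⟩
    root Φ (β w)                                  ∎)
    where open ≡-Reasoning

  N∖β : W Δ → Fin (m Φ) → Set
  N∖β w j = N Δ w j × j ≢ β w

  N∖β⇔Nγ : ∀ w j → N∖β w j ⇔ Nγ Δ γ w j
  N∖β⇔Nγ w j = mk⇔
    (λ ((j⁺ , w⁻¹j⁻) , j≢β) → j⁺ , w⁻¹j⁻ , λ -w⁻¹j≡γ → j≢β (β-unique w j (w⁻¹j≡ -w⁻¹j≡γ)))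
    (λ (j⁺ , w⁻¹j⁻ , -w⁻¹j≢γ) → (j⁺ , w⁻¹j⁻) , λ { refl → -w⁻¹j≢γ -w⁻¹β≡γ })
    where
    w⁻¹j≡ : negv (act Δ (inv Δ w) (root Φ j)) ≡ root Φ γ → act Δ (inv Δ w) (root Φ j) ≡ negv (root Φ γ)
    w⁻¹j≡ e = trans (sym (negv-involutive _)) (cong negv e)
    -w⁻¹β≡γ : negv (act Δ (inv Δ w) (root Φ (β w))) ≡ root Φ γ
    -w⁻¹β≡γ = trans (cong negv (act-inv-β w)) (negv-involutive (root Φ γ))

  N∖β? : ∀ w → Decidable (N∖β w)
  N∖β? w j = N? w j ×-dec ¬? (j Fin.≟ β w)

  ℓγ : W Δ → ℕ
  ℓγ w = size (N∖β? w)

  ℓγ-HasCard : ∀ w → HasCard Δ (Nγ Δ γ w) (ℓγ w)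
  ℓγ-HasCard w = HasSize-⇔ (N∖β⇔Nγ w) (size-HasSize (N∖β? w))

  invCount-β∈N : ∀ w → N Δ w (β w) → invCount w ≡ suc (ℓγ w)
  invCount-β∈N w β∈N = HasSize-unique (invCount-HasCard w) (HasSize-insert (β w) (size-HasSize (N∖β? w)) β∈N)

  invCount-β∉N : ∀ w → ¬ N Δ w (β w) → invCount w ≡ ℓγ w
  invCount-β∉N w β∉N = HasSize-unique (invCount-HasCard w) (HasSize-skip (β w) (size-HasSize (N∖β? w)) β∉N)

  N≡Nγ⇔β∉N : ∀ w → SameSet Δ (N Δ w) (Nγ Δ γ w) ⇔ (¬ N Δ w (β w))
  N≡Nγ⇔β∉N w = mk⇔
    (λ N≡Nγ β∈N → proj₂ (from (N∖β⇔Nγ w (β w)) (to (N≡Nγ (β w)) β∈N)) refl)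
    (λ β∉N j → mk⇔ (λ j∈N → to (N∖β⇔Nγ w j) (j∈N , λ { refl → β∉N j∈N }))
                   (λ j∈Nγ → proj₁ (from (N∖β⇔Nγ w j) j∈Nγ)))

  ℓγ-equal⇔ : ∀ w v → invCount w ℕ.< invCount v →
    ℓγ w ≡ ℓγ v ⇔ (¬ N Δ w (β w) × N Δ v (β v) × invCount v ≡ suc (invCount w))
  ℓγ-equal⇔ w v w<v = mk⇔ forward backward
    where
    forward : ℓγ w ≡ ℓγ v → ¬ N Δ w (β w) × N Δ v (β v) × invCount v ≡ suc (invCount w)
    forward eq = go (N? w (β w)) (N? v (β v))
      where
      go : Dec (N Δ w (β w)) → Dec (N Δ v (β v)) → ¬ N Δ w (β w) × N Δ v (β v) × invCount v ≡ suc (invCount w)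
      go (no β∉Nw) (yes β∈Nv) = β∉Nw , β∈Nv ,
        trans (invCount-β∈N v β∈Nv) (cong suc (trans (sym eq) (sym (invCount-β∉N w β∉Nw))))
      go (no β∉Nw) (no β∉Nv) = contradiction
        (trans (invCount-β∉N w β∉Nw) (trans eq (sym (invCount-β∉N v β∉Nv)))) (ℕP.<⇒≢ w<v)
      go (yes β∈Nw) (yes β∈Nv) = contradiction
        (trans (invCount-β∈N w β∈Nw) (trans (cong suc eq) (sym (invCount-β∈N v β∈Nv)))) (ℕP.<⇒≢ w<v)
      go (yes β∈Nw) (no β∉Nv) = contradiction
        (subst₂ ℕ._<_ (invCount-β∈N w β∈Nw) (trans (invCount-β∉N v β∉Nv) (sym eq)) w<v) (ℕP.<-asym (ℕP.n<1+n (ℓγ w)))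
    backward : ¬ N Δ w (β w) × N Δ v (β v) × invCount v ≡ suc (invCount w) → ℓγ w ≡ ℓγ v
    backward (β∉Nw , β∈Nv , len) = ℕP.suc-injective (begin
      suc (ℓγ w)          ≡⟨ cong suc (invCount-β∉N w β∉Nw) ⟨
      suc (invCount w)    ≡⟨ len ⟨
      invCount v          ≡⟨ invCount-β∈N v β∈Nv ⟩
      suc (ℓγ v)          ∎)
      where open ≡-Reasoning

open Inversions using (invCount; <B⇒invCount-<; <B-cover; IsCover⇒invCount)
open HighestRootInversions using (β; β-unique; act-inv-β; ℓγ; ℓγ-HasCard; N≡Nγ⇔β∉N; ℓγ-equal⇔)

mainTheorem8 : ∀ {n : ℕ} (Φ : RootSystem n) (Δ : Base Φ) → Irreducible Φ →
    (γ : Fin (m Φ)) → IsHighest Δ γ →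
    (v w : W Δ) → _<B_ Δ w v →
    (SameLγ Δ γ w v ⇔
      (IsCover Δ v w × SameSet Δ (N Δ w) (Nγ Δ γ w) ×
        (∃[ j ] (N Δ v j × act Δ (inv Δ v) (root Φ j) ≡ negv (root Φ γ)))))
mainTheorem8 Φ Δ _ γ _ v w w<v = mk⇔ forward backward
  where
  Rhs : Set
  Rhs = IsCover Δ v w × SameSet Δ (N Δ w) (Nγ Δ γ w) ×
        (∃[ j ] (N Δ v j × act Δ (inv Δ v) (root Φ j) ≡ negv (root Φ γ)))
  ℓγ-equal : ℓγ Δ γ w ≡ ℓγ Δ γ v ⇔ (¬ N Δ w (β Δ γ w) × N Δ v (β Δ γ v) × invCount Δ v ≡ suc (invCount Δ w))
  ℓγ-equal = ℓγ-equal⇔ Δ γ w v (<B⇒invCount-< Δ w<v)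
  forward : SameLγ Δ γ w v → Rhs
  forward (k , w-card , v-card) =
    let (β∉Nw , β∈Nv , len) = to ℓγ-equal (trans (HasSize-unique (ℓγ-HasCard Δ γ w) w-card)
                                                 (sym (HasSize-unique (ℓγ-HasCard Δ γ v) v-card)))
    in <B-cover Δ w<v len , from (N≡Nγ⇔β∉N Δ γ w) β∉Nw , β Δ γ v , β∈Nv , act-inv-β Δ γ v
  backward : Rhs → SameLγ Δ γ w v
  backward (cover , N≡Nγ , j , j∈Nv , v⁻¹j≡-γ) =
    ℓγ Δ γ w , ℓγ-HasCard Δ γ w , subst (HasCard Δ (Nγ Δ γ v)) (sym ℓγw≡ℓγv) (ℓγ-HasCard Δ γ v)
    where
    ℓγw≡ℓγv : ℓγ Δ γ w ≡ ℓγ Δ γ v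
    ℓγw≡ℓγv = from ℓγ-equal (to (N≡Nγ⇔β∉N Δ γ w) N≡Nγ , subst (N Δ v) (β-unique Δ γ v j v⁻¹j≡-γ) j∈Nv ,
                             IsCover⇒invCount Δ {v} {w} cover)
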